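{- Let $\alpha>1$ be a quadratic irrational whose minimal polynomial $(x-\alpha)(x-\overline{\alpha})$ has integer coefficients, where $\overline{\alpha}$ denotes the algebraic conjugate of $\alpha$. Let $A(n)=\lfloor n\alpha\rfloor$ for $n\ge 1$ and let $AA$ be the sequence $AA(n)=A(A(n))=\lfloor\lfloor n\alpha\rfloor\alpha\rfloor$, $n\ge1$. Then $AA$ is a generalized Beatty sequence if and only if $|\overline{\alpha}|<1$.
   Context: A generalized Beatty sequence (GBS) is a sequence $V$ of the form $V(n)=pA(n)+qn+r$ for all $n\ge 1$, where $p,q,r$ are integers and $A(n)=\lfloor n\alpha\rfloor$. -}

module Defs where

open import Data.Nat as ℕ using (ℕ; zero; suc)
open import Data.Integer using (ℤ; +_; 0ℤ; 1ℤ; -1ℤ; _+_; _-_; _*_; -_; ∣_∣; _<_; _<?_; _≟_)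
open import Data.Product using (_×_; ∃-syntax)
open import Data.Sum using (_⊎_)
open import Relation.Nullary using (Dec; yes; no)
open import Relation.Nullary.Decidable using (_×-dec_; _⊎-dec_)
open import Relation.Binary.PropositionalEquality using (_≡_)

-- Throughout, α is the real number (t + s·√D)/2 where
--   D = t² − 4d  (discriminant of x² − t x + d = (x−α)(x−ᾱ)),
--   √D is the positive real square root, s ∈ {1, −1}.
-- Then ᾱ = (t − s·√D)/2.  Real numbers of the form a + b√D (a b : ℤ) are
-- handled exactly through integer comparisons (valid when D > 0 is not a square).

disc : ℤ → ℤ → ℤ
disc t d = t * t - (+ 4) * d

-- Pos D a b  :⇔  a + b·√D > 0   (for D > 0 not a perfect square)
Pos : ℤ → ℤ → ℤ → Set
Pos D a b = (0ℤ < a × b * b * D < a * a) ⊎ (0ℤ < b × a * a < b * b * D)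

NonNeg : ℤ → ℤ → ℤ → Set
NonNeg D a b = Pos D a b ⊎ (a ≡ 0ℤ × b ≡ 0ℤ)

pos? : ∀ D a b → Dec (Pos D a b)
pos? D a b = ((0ℤ <? a) ×-dec (b * b * D <? a * a)) ⊎-dec ((0ℤ <? b) ×-dec (a * a <? b * b * D))

nonNeg? : ∀ D a b → Dec (NonNeg D a b)
nonNeg? D a b = pos? D a b ⊎-dec ((a ≟ 0ℤ) ×-dec (b ≟ 0ℤ))

module _ (t d s : ℤ) where

  private
    D : ℤ
    D = disc t d

  -- k ≤ m·α   ⇔   (m t − 2k) + (m s)·√D ≥ 0
  LeMulα : ℤ → ℤ → Set
  LeMulα k m = NonNeg D (m * t - (+ 2) * k) (m * s)

  findFloor : ℕ → ℤ → ℤ → ℤ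
  findFloor zero    m k = k
  findFloor (suc f) m k with nonNeg? D (m * t - (+ 2) * k) (m * s)
  ... | yes _ = k
  ... | no  _ = findFloor f m (k - 1ℤ)

  -- ⌊ m·α ⌋ : since |m α| ≤ B := |m|·(|t| + |D|), the floor lies in [−B, B],
  -- and we search downward from B over all 2B+1 candidates.
  floorMulα : ℤ → ℤ
  floorMulα m = findFloor (suc (2 ℕ.* B)) m (+ B)
    where
    B : ℕ
    B = ∣ m ∣ ℕ.* (∣ t ∣ ℕ.+ ∣ D ∣)

  A : ℕ → ℤ
  A n = floorMulα (+ n)

  AA : ℕ → ℤ
  AA n = floorMulα (A n)

  IsGBS : (ℕ → ℤ) → Set
  IsGBS V = ∃[ p ] ∃[ q ] ∃[ r ] (∀ (n : ℕ) → 1 ℕ.≤ n → V n ≡ p * A n + q * (+ n) + r)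

  -- α > 1   ⇔   (t − 2) + s·√D > 0
  AlphaGt1 : Set
  AlphaGt1 = Pos D (t - (+ 2)) s

  -- |ᾱ| < 1  ⇔  ᾱ < 1 ∧ ᾱ > −1  ⇔  (2 − t) + s√D > 0 ∧ (t + 2) − s√D > 0
  ConjAbsLt1 : Set
  ConjAbsLt1 = Pos D ((+ 2) - t) s × Pos D (t + (+ 2)) (- s)

-- Write α = (t + s√D)/2 and compute in ℤ[√D], ordered through √D ↦ s√D. Since α² = tα − d, for a = ⌊nα⌋
-- one has aα = ta − dn + ᾱ{nα}. So if |ᾱ| < 1, then ⌊aα⌋ = ta − dn + r with r = 0 or r = −1 according to the
-- sign of ᾱ. Conversely, if ⌊aα⌋ = pa + qn + r for all n, then n(α² − pα − q) stays bounded, which forces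
-- p = t and q = −d. Then W(n) = {nα}(ᾱ − 1) − r is bounded and gets multiplied by ᾱ when n is replaced by
-- ⌊nα⌋; iterating from some n with W(n) ≠ 0 rules out |ᾱ| > 1.
module Submission where

open import Agda.Builtin.FromNat using (Number; fromNat)
open import Algebra.Bundles using (CommutativeRing)
open import Algebra.Structures using (IsCommutativeRing)
open import Data.Empty using (⊥; ⊥-elim)
open import Data.Integer as ℤ using (ℤ; +_; +[1+_]; -[1+_]; 0ℤ; 1ℤ; -1ℤ; +<+; +≤+)
import Data.Integer.Properties as ℤₚ
open import Data.Integer.Tactic.RingSolver as ℤ-Solver using ()
open import Data.Maybe using (Maybe; just; nothing)
open import Data.Nat as ℕ using (ℕ; zero; suc; z≤n; s≤s; NonZero)
import Data.Nat.Literals as ℕLiterals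
import Data.Nat.Properties as ℕₚ
open import Data.Nat.Coprimality using (Coprime; coprime-/gcd; coprime-divisor)
import Data.Nat.Coprimality as Coprimality
open import Data.Nat.DivMod using (_/_; m*[n/m]≡n)
open import Data.Nat.Divisibility using (divides; ∣-refl)
open import Data.Nat.GCD using (gcd; gcd[m,n]∣m; gcd[m,n]∣n; gcd[m,n]≢0)
open import Data.Nat.Tactic.RingSolver as ℕ-Solver using ()
open import Data.Product using (_×_; _,_; proj₁; proj₂; ∃-syntax; uncurry)
open import Data.Sum using (_⊎_; inj₁; inj₂; [_,_]′)
open import Data.Unit using (⊤; tt)
open import Defs
open import Function using (_∘_; case_of_; id)
open import Function.Bundles using (_⇔_; mk⇔; Equivalence)
open import Level using (0ℓ)
open import Relation.Binary.Definitions using (tri<; tri≈; tri>)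
open import Relation.Binary.PropositionalEquality
open import Relation.Nullary using (¬_; yes; no)
open import Tactic.RingSolver using (solve-∀)
open import Tactic.RingSolver.Core.AlmostCommutativeRing using (AlmostCommutativeRing; fromCommutativeRing)

-- Importing fromNat overloads numeric literals (used for ℤ[√ D ]); ℕ literals then need their own instance,
-- and tt must be in scope to discharge the literals' trivial constraints.
instance
  ℕ-number : Number ℕ
  ℕ-number = ℕLiterals.number

module NonSquare where
  open import Data.Nat using (_*_)
  open import Data.Nat.Divisibility using (_∣_)

  coprime-square-ratio : ∀ {a b e} → Coprime a b → a * a ≡ b * b * e → a * a ≡ e
  coprime-square-ratio {a} {b} {e} a⊥b eq = begin
    a * a      ≡⟨ eq ⟩
    b * b * e  ≡⟨ cong (λ x → x * x * e) b≡1 ⟩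
    1 * 1 * e  ≡⟨ ℕₚ.*-identityˡ e ⟩
    e          ∎
    where
    open ≡-Reasoning
    rearrange : ∀ b e → b * b * e ≡ b * e * b
    rearrange = ℕ-Solver.solve-∀
    b∣a : b ∣ a
    b∣a = coprime-divisor (Coprimality.sym a⊥b) (divides (b * e) (trans eq (rearrange b e)))
    b≡1 : b ≡ 1
    b≡1 = a⊥b (b∣a , ∣-refl)

  square-ratio⇒square : ∀ m n e → n ≢ 0 → m * m ≡ n * n * e → ∃[ k ] k * k ≡ e
  square-ratio⇒square m n e n≢0 eq =
    m / g , coprime-square-ratio (coprime-/gcd m n) (ℕₚ.*-cancelˡ-≡ _ _ (g * g) scaled)
    where
    g = gcd m n
    instance
      g≢0 : NonZero g
      g≢0 = ℕ.≢-nonZero (gcd[m,n]≢0 m n (inj₂ n≢0))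
      g*g≢0 : NonZero (g * g)
      g*g≢0 = ℕₚ.m*n≢0 g g
    expand : ∀ g x → (g * x) * (g * x) ≡ g * g * (x * x)
    expand = ℕ-Solver.solve-∀
    expand-e : ∀ g x e → (g * x) * (g * x) * e ≡ g * g * (x * x * e)
    expand-e = ℕ-Solver.solve-∀
    m≡ : g * (m / g) ≡ m
    m≡ = m*[n/m]≡n (gcd[m,n]∣m m n)
    n≡ : g * (n / g) ≡ n
    n≡ = m*[n/m]≡n (gcd[m,n]∣n m n)
    scaled : g * g * ((m / g) * (m / g)) ≡ g * g * ((n / g) * (n / g) * e)
    scaled = begin
      g * g * ((m / g) * (m / g))        ≡⟨ expand g (m / g) ⟨
      (g * (m / g)) * (g * (m / g))      ≡⟨ cong (λ x → x * x) m≡ ⟩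
      m * m                              ≡⟨ eq ⟩
      n * n * e                          ≡⟨ cong (λ x → x * x * e) n≡ ⟨
      (g * (n / g)) * (g * (n / g)) * e  ≡⟨ expand-e g (n / g) e ⟩
      g * g * ((n / g) * (n / g) * e)    ∎
      where open ≡-Reasoning

nonsquare⇒irrational : ∀ {E} → (∀ k → k ℤ.* k ≢ + E) → ∀ a b → b ≢ 0ℤ → a ℤ.* a ≢ b ℤ.* b ℤ.* + E
nonsquare⇒irrational {E} nonsquare a b b≢0 eq =
  nonsquare (+ k) (trans (sym (ℤₚ.pos-* k k)) (cong +_ k*k≡E))
  where
  abs-eq : ℤ.∣ a ∣ ℕ.* ℤ.∣ a ∣ ≡ ℤ.∣ b ∣ ℕ.* ℤ.∣ b ∣ ℕ.* E
  abs-eq = begin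
    ℤ.∣ a ∣ ℕ.* ℤ.∣ a ∣                ≡⟨ ℤₚ.abs-* a a ⟨
    ℤ.∣ a ℤ.* a ∣                      ≡⟨ cong ℤ.∣_∣ eq ⟩
    ℤ.∣ b ℤ.* b ℤ.* + E ∣              ≡⟨ ℤₚ.abs-* (b ℤ.* b) (+ E) ⟩
    ℤ.∣ b ℤ.* b ∣ ℕ.* E                ≡⟨ cong (ℕ._* E) (ℤₚ.abs-* b b) ⟩
    ℤ.∣ b ∣ ℕ.* ℤ.∣ b ∣ ℕ.* E          ∎
    where open ≡-Reasoning
  root = NonSquare.square-ratio⇒square ℤ.∣ a ∣ ℤ.∣ b ∣ E (b≢0 ∘ ℤₚ.∣i∣≡0⇒i≡0) abs-eq
  k = proj₁ root
  k*k≡E = proj₂ root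

record ℤ[√_] (D : ℤ) : Set where
  constructor ⟨_,_⟩
  field
    re im : ℤ

open ℤ[√_] public

⟨⟩-cong : ∀ {D a b c e} → a ≡ c → b ≡ e → _≡_ {A = ℤ[√ D ]} ⟨ a , b ⟩ ⟨ c , e ⟩
⟨⟩-cong refl refl = refl

instance
  ℤ[√]-number : ∀ {D} → Number ℤ[√ D ]
  ℤ[√]-number = record { Constraint = λ _ → ⊤ ; fromNat = λ n → ⟨ + n , 0ℤ ⟩ }

private
  module CoordinateIdentities where
    open import Data.Integer using (_+_; _-_; _*_; -_)

    *-assoc-re : ∀ a b c e f g D → (a * c + b * e * D) * f + (a * e + b * c) * g * D ≡ a * (c * f + e * g * D) + b * (c * g + e * f) * D
    *-assoc-re = ℤ-Solver.solve-∀
    *-assoc-im : ∀ a b c e f g D → (a * c + b * e * D) * g + (a * e + b * c) * f ≡ a * (c * g + e * f) + b * (c * f + e * g * D)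
    *-assoc-im = ℤ-Solver.solve-∀
    *-identityˡ-re : ∀ a b D → 1ℤ * a + 0ℤ * b * D ≡ a
    *-identityˡ-re = ℤ-Solver.solve-∀
    *-identityˡ-im : ∀ a b → 1ℤ * b + 0ℤ * a ≡ b
    *-identityˡ-im = ℤ-Solver.solve-∀
    *-identityʳ-re : ∀ a b D → a * 1ℤ + b * 0ℤ * D ≡ a
    *-identityʳ-re = ℤ-Solver.solve-∀
    *-identityʳ-im : ∀ a b → a * 0ℤ + b * 1ℤ ≡ b
    *-identityʳ-im = ℤ-Solver.solve-∀
    distribˡ-re : ∀ a b c e f g D → a * (c + f) + b * (e + g) * D ≡ (a * c + b * e * D) + (a * f + b * g * D)
    distribˡ-re = ℤ-Solver.solve-∀
    distribˡ-im : ∀ a b c e f g → a * (e + g) + b * (c + f) ≡ (a * e + b * c) + (a * g + b * f)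
    distribˡ-im = ℤ-Solver.solve-∀
    distribʳ-re : ∀ a b c e f g D → (c + f) * a + (e + g) * b * D ≡ (c * a + e * b * D) + (f * a + g * b * D)
    distribʳ-re = ℤ-Solver.solve-∀
    distribʳ-im : ∀ a b c e f g → (c + f) * b + (e + g) * a ≡ (c * b + e * a) + (f * b + g * a)
    distribʳ-im = ℤ-Solver.solve-∀
    *-comm-re : ∀ a b c e D → a * c + b * e * D ≡ c * a + e * b * D
    *-comm-re = ℤ-Solver.solve-∀
    *-comm-im : ∀ a b c e → a * e + b * c ≡ c * b + e * a
    *-comm-im = ℤ-Solver.solve-∀
    *-conj-re : ∀ a b D → a * a + b * - b * D ≡ a * a - b * b * D
    *-conj-re = ℤ-Solver.solve-∀
    *-conj-im : ∀ a b → a * - b + b * a ≡ 0ℤ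
    *-conj-im = ℤ-Solver.solve-∀
    ι-*-re : ∀ a b D → a * b ≡ a * b + 0ℤ * 0ℤ * D
    ι-*-re = ℤ-Solver.solve-∀
    ι-*-im : ∀ a b → 0ℤ ≡ a * 0ℤ + 0ℤ * b
    ι-*-im = ℤ-Solver.solve-∀

module QuadraticRing (D : ℤ) where

  infixl 6 _+_
  infixl 7 _*_
  infix 8 -_

  _+_ : ℤ[√ D ] → ℤ[√ D ] → ℤ[√ D ]
  ⟨ a , b ⟩ + ⟨ c , e ⟩ = ⟨ a ℤ.+ c , b ℤ.+ e ⟩

  -_ : ℤ[√ D ] → ℤ[√ D ]
  - ⟨ a , b ⟩ = ⟨ ℤ.- a , ℤ.- b ⟩

  _*_ : ℤ[√ D ] → ℤ[√ D ] → ℤ[√ D ]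
  ⟨ a , b ⟩ * ⟨ c , e ⟩ = ⟨ a ℤ.* c ℤ.+ b ℤ.* e ℤ.* D , a ℤ.* e ℤ.+ b ℤ.* c ⟩

  ι : ℤ → ℤ[√ D ]
  ι a = ⟨ a , 0ℤ ⟩

  conj : ℤ[√ D ] → ℤ[√ D ]
  conj ⟨ a , b ⟩ = ⟨ a , ℤ.- b ⟩

  norm : ℤ[√ D ] → ℤ
  norm ⟨ a , b ⟩ = a ℤ.* a ℤ.- b ℤ.* b ℤ.* D

  0# 1# : ℤ[√ D ]
  0# = ι 0ℤ
  1# = ι 1ℤ

  isCommutativeRing : IsCommutativeRing _≡_ _+_ _*_ -_ 0# 1#
  isCommutativeRing = record
    { isRing = record
      { +-isAbelianGroup = record
        { isGroup = record
          { isMonoid = record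
            { isSemigroup = record
              { isMagma = record { isEquivalence = isEquivalence ; ∙-cong = cong₂ _+_ }
              ; assoc = λ { ⟨ a , b ⟩ ⟨ c , e ⟩ ⟨ f , g ⟩ → ⟨⟩-cong (ℤₚ.+-assoc a c f) (ℤₚ.+-assoc b e g) }
              }
            ; identity = (λ { ⟨ a , b ⟩ → ⟨⟩-cong (ℤₚ.+-identityˡ a) (ℤₚ.+-identityˡ b) })
                       , (λ { ⟨ a , b ⟩ → ⟨⟩-cong (ℤₚ.+-identityʳ a) (ℤₚ.+-identityʳ b) })
            }
          ; inverse = (λ { ⟨ a , b ⟩ → ⟨⟩-cong (ℤₚ.+-inverseˡ a) (ℤₚ.+-inverseˡ b) })
                    , (λ { ⟨ a , b ⟩ → ⟨⟩-cong (ℤₚ.+-inverseʳ a) (ℤₚ.+-inverseʳ b) })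
          ; ⁻¹-cong = cong (-_)
          }
        ; comm = λ { ⟨ a , b ⟩ ⟨ c , e ⟩ → ⟨⟩-cong (ℤₚ.+-comm a c) (ℤₚ.+-comm b e) }
        }
      ; *-cong = cong₂ _*_
      ; *-assoc = λ { ⟨ a , b ⟩ ⟨ c , e ⟩ ⟨ f , g ⟩ → ⟨⟩-cong (*-assoc-re a b c e f g D) (*-assoc-im a b c e f g D) }
      ; *-identity = (λ { ⟨ a , b ⟩ → ⟨⟩-cong (*-identityˡ-re a b D) (*-identityˡ-im a b) })
                   , (λ { ⟨ a , b ⟩ → ⟨⟩-cong (*-identityʳ-re a b D) (*-identityʳ-im a b) })
      ; distrib = (λ { ⟨ a , b ⟩ ⟨ c , e ⟩ ⟨ f , g ⟩ → ⟨⟩-cong (distribˡ-re a b c e f g D) (distribˡ-im a b c e f g) })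
                , (λ { ⟨ a , b ⟩ ⟨ c , e ⟩ ⟨ f , g ⟩ → ⟨⟩-cong (distribʳ-re a b c e f g D) (distribʳ-im a b c e f g) })
      }
    ; *-comm = λ { ⟨ a , b ⟩ ⟨ c , e ⟩ → ⟨⟩-cong (*-comm-re a b c e D) (*-comm-im a b c e) }
    }
    where open CoordinateIdentities

  commutativeRing : CommutativeRing 0ℓ 0ℓ
  commutativeRing = record { isCommutativeRing = isCommutativeRing }

  *-conj : ∀ x → x * conj x ≡ ι (norm x)
  *-conj ⟨ a , b ⟩ = ⟨⟩-cong (*-conj-re a b D) (*-conj-im a b)
    where open CoordinateIdentities

  ι-* : ∀ a b → ι (a ℤ.* b) ≡ ι a * ι b
  ι-* a b = ⟨⟩-cong (ι-*-re a b D) (ι-*-im a b)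
    where open CoordinateIdentities

  -- The reflective solver only recognises the operations of this record, and only when it is passed a ring
  -- defined in the current module: clients state identities with its projections and a local copy of it.
  ring : AlmostCommutativeRing 0ℓ 0ℓ
  ring = fromCommutativeRing commutativeRing is-0#
    where
    is-0# : ∀ x → Maybe (0# ≡ x)
    is-0# ⟨ + 0 , + 0 ⟩ = just refl
    is-0# _ = nothing

module IntegerFacts where
  open import Data.Integer using (_+_; _-_; _*_; -_; _<_; _≤_)

  *-pos : ∀ {i j} → 0ℤ < i → 0ℤ < j → 0ℤ < i * j
  *-pos {+[1+ m ]} {+[1+ n ]} _ _ = +<+ (s≤s z≤n)
  *-pos {+ 0} (+<+ ())
  *-pos {+[1+ m ]} {+ 0} _ (+<+ ())

  *-nonNeg : ∀ {i j} → 0ℤ ≤ i → 0ℤ ≤ j → 0ℤ ≤ i * j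
  *-nonNeg {+ m} {+ n} _ _ = subst (0ℤ ≤_) (ℤₚ.pos-* m n) (+≤+ z≤n)

  square-nonNeg : ∀ i → 0ℤ ≤ i * i
  square-nonNeg (+ n) = *-nonNeg {+ n} {+ n} (+≤+ z≤n) (+≤+ z≤n)
  square-nonNeg -[1+ n ] = *-nonNeg {+[1+ n ]} {+[1+ n ]} (+≤+ z≤n) (+≤+ z≤n)

  0<⇒1≤ : ∀ {k} → 0ℤ < k → 1ℤ ≤ k
  0<⇒1≤ {+[1+ n ]} _ = +≤+ (s≤s z≤n)
  0<⇒1≤ {+ 0} (+<+ ())

  0<⇒1≤∣∣ : ∀ {k} → 0ℤ < k → 1 ℕ.≤ ℤ.∣ k ∣
  0<⇒1≤∣∣ {+[1+ n ]} _ = s≤s z≤n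
  0<⇒1≤∣∣ {+ 0} (+<+ ())

  ∣i∣-i-nonNeg : ∀ i → 0ℤ ≤ + ℤ.∣ i ∣ - i
  ∣i∣-i-nonNeg (+ n) = ℤₚ.≤-reflexive (sym (ℤₚ.+-inverseʳ (+ n)))
  ∣i∣-i-nonNeg -[1+ n ] = +≤+ z≤n

  ∣i∣+i-nonNeg : ∀ i → 0ℤ ≤ + ℤ.∣ i ∣ + i
  ∣i∣+i-nonNeg (+ n) = +≤+ z≤n
  ∣i∣+i-nonNeg -[1+ n ] = ℤₚ.≤-reflexive (sym (ℤₚ.+-inverseʳ +[1+ n ]))

  2*<2*+2⇒≤ : ∀ {k f} → + 2 * k < + 2 * f + + 2 → k ≤ f
  2*<2*+2⇒≤ {k} {f} 2k<2f+2 = subst (k ≤_) (pred-of-succ f) (ℤₚ.i<j⇒i≤pred[j] k<f+1)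
    where
    factor : ∀ f → + 2 * f + + 2 ≡ + 2 * (f + 1ℤ)
    factor = ℤ-Solver.solve-∀
    pred-of-succ : ∀ f → -1ℤ + (f + 1ℤ) ≡ f
    pred-of-succ = ℤ-Solver.solve-∀
    k<f+1 : k < f + 1ℤ
    k<f+1 = ℤₚ.*-cancelˡ-<-nonNeg (+ 2) (subst (+ 2 * k <_) (factor f) 2k<2f+2)

  <⇒0<- : ∀ {i j} → i < j → 0ℤ < j - i
  <⇒0<- {i} {j} i<j = subst (_< j - i) (ℤₚ.+-inverseʳ i) (ℤₚ.+-monoˡ-< (- i) i<j)

  0<-⇒< : ∀ {i j k} → j - i ≡ k → 0ℤ < k → i < j
  0<-⇒< {i} {j} refl 0<j-i = subst₂ _<_ (ℤₚ.+-identityˡ i) (shift i j) (ℤₚ.+-monoˡ-< i 0<j-i)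
    where
    shift : ∀ i j → j - i + i ≡ j
    shift = ℤ-Solver.solve-∀

  *-cancelˡ-pos : ∀ {k i} → 0ℤ < k → 0ℤ < k * i → 0ℤ < i
  *-cancelˡ-pos {k} {i} 0<k 0<k*i with ℤₚ.<-cmp 0ℤ i
  ... | tri< 0<i _ _ = 0<i
  ... | tri≈ _ refl _ = ⊥-elim (ℤₚ.<-irrefl (sym (ℤₚ.*-zeroʳ k)) 0<k*i)
  ... | tri> _ _ i<0 = ⊥-elim (ℤₚ.<-asym 0<k*i k*i<0)
    where
    k*i<0 : k * i < 0ℤ
    k*i<0 = ℤₚ.neg-cancel-< (subst (0ℤ <_) (sym (ℤₚ.neg-distribʳ-* k i)) (*-pos 0<k (ℤₚ.neg-mono-< i<0)))

  *-nonNeg-nonPos : ∀ {i j} → 0ℤ ≤ i → j ≤ 0ℤ → i * j ≤ 0ℤ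
  *-nonNeg-nonPos {i} {j} 0≤i j≤0 =
    ℤₚ.neg-cancel-≤ (subst (0ℤ ≤_) (sym (ℤₚ.neg-distribʳ-* i j)) (*-nonNeg 0≤i (ℤₚ.neg-mono-≤ j≤0)))

  product-and-sum-pos : ∀ {i j} → 0ℤ < i * j → 0ℤ < i + j → 0ℤ < i × 0ℤ < j
  product-and-sum-pos {i} {j} 0<ij 0<i+j with 0ℤ ℤ.<? i | 0ℤ ℤ.<? j
  ... | yes 0<i | yes 0<j = 0<i , 0<j
  ... | yes 0<i | no 0≮j =
    ⊥-elim (ℤₚ.<⇒≱ 0<ij (*-nonNeg-nonPos (ℤₚ.<⇒≤ 0<i) (ℤₚ.≮⇒≥ 0≮j)))
  ... | no 0≮i | yes 0<j =
    ⊥-elim (ℤₚ.<⇒≱ 0<ij (subst (_≤ 0ℤ) (ℤₚ.*-comm j i) (*-nonNeg-nonPos (ℤₚ.<⇒≤ 0<j) (ℤₚ.≮⇒≥ 0≮i))))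
  ... | no 0≮i | no 0≮j = ⊥-elim (ℤₚ.<⇒≱ 0<i+j (ℤₚ.+-mono-≤ (ℤₚ.≮⇒≥ 0≮i) (ℤₚ.≮⇒≥ 0≮j)))

  square-<⇒abs-< : ∀ {i j} → 0ℤ < j → i * i < j * j → 0ℤ < j + i × 0ℤ < j - i
  square-<⇒abs-< {i} {j} 0<j i²<j² =
    product-and-sum-pos (subst (0ℤ <_) (product i j) (<⇒0<- i²<j²)) (subst (0ℤ <_) (sum i j) (ℤₚ.+-mono-< 0<j 0<j))
    where
    product : ∀ i j → j * j - i * i ≡ (j + i) * (j - i)
    product = ℤ-Solver.solve-∀
    sum : ∀ i j → j + j ≡ (j + i) + (j - i)
    sum = ℤ-Solver.solve-∀

module Positivity (D : ℤ) (0<D : 0ℤ ℤ.< D)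
                  (irrational : ∀ a b → b ≢ 0ℤ → a ℤ.* a ≢ b ℤ.* b ℤ.* D) where
  open IntegerFacts
  open QuadraticRing D using (ι; conj; norm; *-conj)
  open import Data.Integer using (_+_; _-_; _*_; -_; _<_; _≤_)

  private
    ring : AlmostCommutativeRing 0ℓ 0ℓ
    ring = QuadraticRing.ring D

  module R = AlmostCommutativeRing ring
  open R using (0#)

  private
    neg-* : ∀ x y → R.- x R.* y ≡ R.- (x R.* y)
    neg-* = solve-∀ ring

    zero-* : ∀ y → 0# R.* y ≡ 0#
    zero-* = solve-∀ ring

    distrib : ∀ x y z → y R.* z R.+ x R.* z ≡ (x R.+ y) R.* z
    distrib = solve-∀ ring

  Positive : ℤ[√ D ] → Set
  Positive ⟨ a , b ⟩ = Pos D a b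

  private
    neg-square : ∀ i → - i * - i ≡ i * i
    neg-square = ℤ-Solver.solve-∀

    square-D-nonNeg : ∀ b → 0ℤ ≤ b * b * D
    square-D-nonNeg b = *-nonNeg (square-nonNeg b) (ℤₚ.<⇒≤ 0<D)

    +-pos-nonNeg-nonNeg : ∀ {i j k} → 0ℤ < i → 0ℤ ≤ j → 0ℤ ≤ k → 0ℤ < i + j + k
    +-pos-nonNeg-nonNeg 0<i 0≤j 0≤k = ℤₚ.+-mono-<-≤ (ℤₚ.+-mono-<-≤ 0<i 0≤j) 0≤k

  ¬positive-0# : ¬ Positive 0#
  ¬positive-0# (inj₁ (+<+ () , _))
  ¬positive-0# (inj₂ (+<+ () , _))

  positive-asym : ∀ {x} → Positive x → ¬ Positive (R.- x)
  positive-asym {⟨ a , b ⟩} (inj₁ (0<a , _)) (inj₁ (0<-a , _)) =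
    ℤₚ.<-asym 0<a (ℤₚ.neg-cancel-< 0<-a)
  positive-asym {⟨ a , b ⟩} (inj₁ (_ , b²D<a²)) (inj₂ (_ , a²<b²D)) =
    ℤₚ.<-asym b²D<a² (subst₂ _<_ (neg-square a) (cong (_* D) (neg-square b)) a²<b²D)
  positive-asym {⟨ a , b ⟩} (inj₂ (_ , a²<b²D)) (inj₁ (_ , b²D<a²)) =
    ℤₚ.<-asym a²<b²D (subst₂ _<_ (cong (_* D) (neg-square b)) (neg-square a) b²D<a²)
  positive-asym {⟨ a , b ⟩} (inj₂ (0<b , _)) (inj₂ (0<-b , _)) =
    ℤₚ.<-asym 0<b (ℤₚ.neg-cancel-< 0<-b)

  positive-trichotomy : ∀ x → Positive x ⊎ Positive (R.- x) ⊎ x ≡ 0#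
  positive-trichotomy ⟨ a , b ⟩ with ℤₚ.<-cmp (a * a) (b * b * D)
  ... | tri< a²<b²D _ _ with ℤₚ.<-cmp 0ℤ b
  ...   | tri< 0<b _ _ = inj₁ (inj₂ (0<b , a²<b²D))
  ...   | tri≈ _ refl _ = ⊥-elim (ℤₚ.<⇒≱ a²<b²D (square-nonNeg a))
  ...   | tri> _ _ b<0 =
    inj₂ (inj₁ (inj₂ (ℤₚ.neg-mono-< b<0 , subst₂ _<_ (sym (neg-square a)) (cong (_* D) (sym (neg-square b))) a²<b²D)))
  positive-trichotomy ⟨ a , b ⟩ | tri> _ _ b²D<a² with ℤₚ.<-cmp 0ℤ a
  ...   | tri< 0<a _ _ = inj₁ (inj₁ (0<a , b²D<a²))
  ...   | tri≈ _ refl _ = ⊥-elim (ℤₚ.<⇒≱ b²D<a² (square-D-nonNeg b))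
  ...   | tri> _ _ a<0 =
    inj₂ (inj₁ (inj₁ (ℤₚ.neg-mono-< a<0 , subst₂ _<_ (cong (_* D) (sym (neg-square b))) (sym (neg-square a)) b²D<a²)))
  positive-trichotomy ⟨ a , b ⟩ | tri≈ _ a²≡b²D _ with b ℤ.≟ 0ℤ
  ...   | no b≢0 = ⊥-elim (irrational a b b≢0 a²≡b²D)
  ...   | yes refl with ℤₚ.i*j≡0⇒i≡0∨j≡0 a a²≡b²D
  ...     | inj₁ refl = inj₂ (inj₂ refl)
  ...     | inj₂ refl = inj₂ (inj₂ refl)

  private
    dominant-irrational-parts : ∀ {a b c e} → 0ℤ < b → a * a < b * b * D → 0ℤ < e → c * c < e * e * D →
                                0ℤ < b * e * D + a * c × 0ℤ < b * e * D - a * c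
    dominant-irrational-parts {a} {b} {c} {e} 0<b a²<b²D 0<e c²<e²D =
      square-<⇒abs-< (*-pos (*-pos 0<b 0<e) 0<D)
        (0<-⇒< (expand a b c e D) (ℤₚ.+-mono-<-≤ (*-pos (<⇒0<- a²<b²D) (*-pos (*-pos 0<e 0<e) 0<D))
                                                 (*-nonNeg (square-nonNeg a) (ℤₚ.<⇒≤ (<⇒0<- c²<e²D)))))
      where
      expand : ∀ a b c e D → b * e * D * (b * e * D) - a * c * (a * c) ≡ (b * b * D - a * a) * (e * e * D) + a * a * (e * e * D - c * c)
      expand = ℤ-Solver.solve-∀

  positive-* : ∀ {x y} → Positive x → Positive y → Positive (x R.* y)
  positive-* {⟨ a , b ⟩} {⟨ c , e ⟩} (inj₁ (0<a , b²D<a²)) (inj₁ (0<c , e²D<c²)) =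
    inj₁ (proj₁ (square-<⇒abs-< (*-pos 0<a 0<c) (0<-⇒< (re-expand a b c e D) re-pos))
         , 0<-⇒< (norm-expand a b c e D) (*-pos (<⇒0<- b²D<a²) (<⇒0<- e²D<c²)))
    where
    re-expand : ∀ a b c e D → a * c * (a * c) - b * e * D * (b * e * D) ≡
                (a * a - b * b * D) * (c * c - e * e * D) + b * b * D * (c * c - e * e * D) + e * e * D * (a * a - b * b * D)
    re-expand = ℤ-Solver.solve-∀
    norm-expand : ∀ a b c e D → (a * c + b * e * D) * (a * c + b * e * D) - (a * e + b * c) * (a * e + b * c) * D ≡
                  (a * a - b * b * D) * (c * c - e * e * D)
    norm-expand = ℤ-Solver.solve-∀
    re-pos = +-pos-nonNeg-nonNeg (*-pos (<⇒0<- b²D<a²) (<⇒0<- e²D<c²))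
               (*-nonNeg (square-D-nonNeg b) (ℤₚ.<⇒≤ (<⇒0<- e²D<c²))) (*-nonNeg (square-D-nonNeg e) (ℤₚ.<⇒≤ (<⇒0<- b²D<a²)))
  positive-* {⟨ a , b ⟩} {⟨ c , e ⟩} (inj₁ (0<a , b²D<a²)) (inj₂ (0<e , c²<e²D)) =
    inj₂ (proj₁ (square-<⇒abs-< (*-pos 0<a 0<e) (0<-⇒< refl (*-cancelˡ-pos 0<D (subst (0ℤ <_) (sym (im-expand a b c e D)) im-pos))))
         , 0<-⇒< (norm-expand a b c e D) (*-pos (<⇒0<- b²D<a²) (<⇒0<- c²<e²D)))
    where
    im-expand : ∀ a b c e D → D * (a * e * (a * e) - b * c * (b * c)) ≡ a * a * (e * e * D - c * c) + c * c * (a * a - b * b * D)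
    im-expand = ℤ-Solver.solve-∀
    norm-expand : ∀ a b c e D → (a * e + b * c) * (a * e + b * c) * D - (a * c + b * e * D) * (a * c + b * e * D) ≡
                  (a * a - b * b * D) * (e * e * D - c * c)
    norm-expand = ℤ-Solver.solve-∀
    im-pos = ℤₚ.+-mono-<-≤ (*-pos (*-pos 0<a 0<a) (<⇒0<- c²<e²D)) (*-nonNeg (square-nonNeg c) (ℤₚ.<⇒≤ (<⇒0<- b²D<a²)))
  positive-* {x} {y} px@(inj₂ _) py@(inj₁ _) = subst Positive (R.*-comm y x) (positive-* py px)
  positive-* {⟨ a , b ⟩} {⟨ c , e ⟩} (inj₂ (0<b , a²<b²D)) (inj₂ (0<e , c²<e²D)) =
    inj₁ (subst (0ℤ <_) (ℤₚ.+-comm (b * e * D) (a * c)) (proj₁ (dominant-irrational-parts {a} {b} {c} {e} 0<b a²<b²D 0<e c²<e²D))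
         , 0<-⇒< (norm-expand a b c e D) (*-pos (<⇒0<- a²<b²D) (<⇒0<- c²<e²D)))
    where
    norm-expand : ∀ a b c e D → (a * c + b * e * D) * (a * c + b * e * D) - (a * e + b * c) * (a * e + b * c) * D ≡
                  (b * b * D - a * a) * (e * e * D - c * c)
    norm-expand = ℤ-Solver.solve-∀

  positive-+ι : ∀ {x k} → Positive x → 0ℤ < k → Positive (x R.+ ι k)
  positive-+ι {⟨ a , b ⟩} {k} px 0<k = subst (Pos D (a + k)) (sym (ℤₚ.+-identityʳ b)) (shift px)
    where
    shift : Pos D a b → Pos D (a + k) b
    shift (inj₁ (0<a , b²D<a²)) =
      inj₁ (ℤₚ.+-mono-< 0<a 0<k
           , 0<-⇒< (expand a k b D) (ℤₚ.+-mono-< (<⇒0<- b²D<a²) (*-pos 0<k (ℤₚ.+-mono-< (ℤₚ.+-mono-< 0<a 0<a) 0<k))))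
      where
      expand : ∀ a k b D → (a + k) * (a + k) - b * b * D ≡ (a * a - b * b * D) + k * ((a + a) + k)
      expand = ℤ-Solver.solve-∀
    shift (inj₂ (0<b , a²<b²D)) with ℤₚ.<-cmp ((a + k) * (a + k)) (b * b * D)
    ... | tri< lt _ _ = inj₂ (0<b , lt)
    ... | tri≈ _ eq _ = ⊥-elim (irrational (a + k) b (λ b≡0 → ℤₚ.<-irrefl (sym b≡0) 0<b) eq)
    ... | tri> _ _ gt = inj₁ (*-cancelˡ-pos {+ 2} (+<+ (s≤s z≤n)) (subst (0ℤ <_) (twice a k) (ℤₚ.+-mono-< 0<2a+k 0<k)) , gt)
      where
      growth : ∀ a k → (a + k) * (a + k) - a * a ≡ k * ((a + a) + k)
      growth = ℤ-Solver.solve-∀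
      twice : ∀ a k → (a + a + k) + k ≡ + 2 * (a + k)
      twice = ℤ-Solver.solve-∀
      0<2a+k : 0ℤ < a + a + k
      0<2a+k = *-cancelˡ-pos 0<k (subst (0ℤ <_) (growth a k) (<⇒0<- (ℤₚ.<-trans a²<b²D gt)))

  positive-cancelʳ : ∀ {x y} → Positive (x R.* y) → Positive y → Positive x
  positive-cancelʳ {x} {y} pxy py with positive-trichotomy x
  ... | inj₁ px = px
  ... | inj₂ (inj₁ p-x) = ⊥-elim (positive-asym pxy (subst Positive (neg-* x y) (positive-* p-x py)))

  ... | inj₂ (inj₂ refl) = ⊥-elim (¬positive-0# (subst Positive (zero-* y) pxy))


  positive-+ : ∀ {x y} → Positive x → Positive y → Positive (x R.+ y)
  positive-+ {x@(⟨ a , b ⟩)} {y} px@(inj₁ (0<a , b²D<a²)) py =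
    positive-cancelʳ (subst Positive expand (positive-+ι (positive-* py p-conj) (<⇒0<- b²D<a²))) p-conj
    where
    -- x · conj x is the positive integer norm x, so positivity of (x + y) · conj x follows from that of y · conj x.
    p-conj : Positive (conj x)
    p-conj = inj₁ (0<a , subst (λ z → z * D < a * a) (sym (neg-square b)) b²D<a²)
    expand : y R.* conj x R.+ ι (norm x) ≡ (x R.+ y) R.* conj x
    expand = trans (cong (y R.* conj x R.+_) (sym (*-conj x))) (distrib x y (conj x))
  positive-+ {x} {y} px@(inj₂ _) py@(inj₁ _) = subst Positive (R.+-comm y x) (positive-+ py px)
  positive-+ {⟨ a , b ⟩} {⟨ c , e ⟩} (inj₂ (0<b , a²<b²D)) (inj₂ (0<e , c²<e²D)) =
    inj₂ (ℤₚ.+-mono-< 0<b 0<e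
         , 0<-⇒< (expand a b c e D) (ℤₚ.+-mono-< (ℤₚ.+-mono-< (<⇒0<- a²<b²D) (<⇒0<- c²<e²D)) (ℤₚ.+-mono-< mixed mixed)))
    where
    expand : ∀ a b c e D → (b + e) * (b + e) * D - (a + c) * (a + c) ≡
             (b * b * D - a * a) + (e * e * D - c * c) + ((b * e * D - a * c) + (b * e * D - a * c))
    expand = ℤ-Solver.solve-∀
    mixed = proj₂ (dominant-irrational-parts {a} {b} {c} {e} 0<b a²<b²D 0<e c²<e²D)

module Cone (D : ℤ) where
  private
    ring : AlmostCommutativeRing 0ℓ 0ℓ
    ring = QuadraticRing.ring D
  open AlmostCommutativeRing ring using (_+_; _*_; -_; 0#)

  record IsPositiveCone (P : ℤ[√ D ] → Set) : Set where
    field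
      +-closed : ∀ {x y} → P x → P y → P (x + y)
      *-closed : ∀ {x y} → P x → P y → P (x * y)
      asym : ∀ {x} → P x → ¬ P (- x)
      trichotomy : ∀ x → P x ⊎ P (- x) ⊎ x ≡ 0#

module Ordered (D : ℤ) (P : ℤ[√ D ] → Set) (cone : Cone.IsPositiveCone D P) where
  private
    ring : AlmostCommutativeRing 0ℓ 0ℓ
    ring = QuadraticRing.ring D
  -- AlmostCommutativeRing declares no fixity for _-_.
  open AlmostCommutativeRing ring using (_+_; _*_; -_; 0#; 1#; *-comm; *-identityʳ) renaming (_-_ to infixl 6 _-_)
  open QuadraticRing D using (ι; ι-*)
  open Cone.IsPositiveCone cone

  infix 4 _<_ _≤_

  record _<_ (x y : ℤ[√ D ]) : Set where
    constructor mk<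
    field
      positive : P (y - x)

  open _<_ public

  _≤_ : ℤ[√ D ] → ℤ[√ D ] → Set
  x ≤ y = x < y ⊎ x ≡ y

  private
    minus-zero : ∀ x → x - 0# ≡ x
    minus-zero = solve-∀ ring
    plus-zero : ∀ x → x + 0# ≡ x
    plus-zero = solve-∀ ring
    difference-trans : ∀ x y z → (z - y) + (y - x) ≡ z - x
    difference-trans = solve-∀ ring
    difference-neg : ∀ x y → - (y - x) ≡ x - y
    difference-neg = solve-∀ ring
    difference-zero : ∀ x y → x + (y - x) ≡ y
    difference-zero = solve-∀ ring
    difference-self : ∀ x → x - x ≡ 0#
    difference-self = solve-∀ ring
    difference-+ : ∀ x y u v → (y - x) + (v - u) ≡ (y + v) - (x + u)
    difference-+ = solve-∀ ring

  0<⇒positive : ∀ {x} → 0# < x → P x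
  0<⇒positive {x} (mk< p) = subst P (minus-zero x) p

  positive⇒0< : ∀ {x} → P x → 0# < x
  positive⇒0< {x} p = mk< (subst P (sym (minus-zero x)) p)

  <-by-difference : ∀ {x y z} → y - x ≡ z → 0# < z → x < y
  <-by-difference refl 0<z = mk< (0<⇒positive 0<z)

  ¬positive-0# : ¬ P 0#
  ¬positive-0# p = asym p p

  <-irrefl : ∀ {x} → ¬ x < x
  <-irrefl {x} (mk< p) = ¬positive-0# (subst P (difference-self x) p)

  <-asym : ∀ {x y} → x < y → ¬ y < x
  <-asym {x} {y} (mk< p) (mk< q) = asym p (subst P (sym (difference-neg x y)) q)

  <-trans : ∀ {x y z} → x < y → y < z → x < z
  <-trans {x} {y} {z} (mk< p) (mk< q) = mk< (subst P (difference-trans x y z) (+-closed q p))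

  <-≤-trans : ∀ {x y z} → x < y → y ≤ z → x < z
  <-≤-trans x<y (inj₁ y<z) = <-trans x<y y<z
  <-≤-trans x<y (inj₂ refl) = x<y

  ≤-<-trans : ∀ {x y z} → x ≤ y → y < z → x < z
  ≤-<-trans (inj₁ x<y) y<z = <-trans x<y y<z
  ≤-<-trans (inj₂ refl) y<z = y<z

  ≤-trans : ∀ {x y z} → x ≤ y → y ≤ z → x ≤ z
  ≤-trans (inj₁ x<y) y≤z = inj₁ (<-≤-trans x<y y≤z)
  ≤-trans (inj₂ refl) y≤z = y≤z

  <-cmp : ∀ x y → x < y ⊎ y < x ⊎ x ≡ y
  <-cmp x y with trichotomy (y - x)
  ... | inj₁ p = inj₁ (mk< p)
  ... | inj₂ (inj₁ q) = inj₂ (inj₁ (mk< (subst P (difference-neg x y) q)))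
  ... | inj₂ (inj₂ y-x≡0) = inj₂ (inj₂ (begin
    x              ≡⟨ plus-zero x ⟨
    x + 0#         ≡⟨ cong (λ z → x + z) y-x≡0 ⟨
    x + (y - x)    ≡⟨ difference-zero x y ⟩
    y              ∎))
    where open ≡-Reasoning

  <⇒0<- : ∀ {x y} → x < y → 0# < y - x
  <⇒0<- (mk< p) = positive⇒0< p

  neg-mono-< : ∀ {x y} → x < y → - y < - x
  neg-mono-< {x} {y} (mk< p) = mk< (subst P (flip x y) p)
    where
    flip : ∀ x y → y - x ≡ - x - - y
    flip = solve-∀ ring

  ≮⇒≥ : ∀ {x y} → ¬ x < y → y ≤ x
  ≮⇒≥ {x} {y} x≮y with <-cmp x y
  ... | inj₁ x<y = ⊥-elim (x≮y x<y)
  ... | inj₂ (inj₁ y<x) = inj₁ y<x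
  ... | inj₂ (inj₂ refl) = inj₂ refl

  ≤∧≢⇒< : ∀ {x y} → x ≤ y → x ≢ y → x < y
  ≤∧≢⇒< (inj₁ x<y) _ = x<y
  ≤∧≢⇒< (inj₂ x≡y) x≢y = ⊥-elim (x≢y x≡y)

  +-mono-< : ∀ {x y u v} → x < y → u < v → x + u < y + v
  +-mono-< {x} {y} {u} {v} (mk< p) (mk< q) = mk< (subst P (difference-+ x y u v) (+-closed p q))

  +-mono-≤-< : ∀ {x y u v} → x ≤ y → u < v → x + u < y + v
  +-mono-≤-< (inj₁ x<y) u<v = +-mono-< x<y u<v
  +-mono-≤-< {x} {u = u} {v} (inj₂ refl) (mk< p) = mk< (subst P (shift x u v) p)
    where
    shift : ∀ x u v → v - u ≡ (x + v) - (x + u)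
    shift = solve-∀ ring

  +-mono-≤ : ∀ {x y u v} → x ≤ y → u ≤ v → x + u ≤ y + v
  +-mono-≤ (inj₁ x<y) (inj₁ u<v) = inj₁ (+-mono-< x<y u<v)
  +-mono-≤ {x} {y} {u} (inj₁ (mk< p)) (inj₂ refl) = inj₁ (mk< (subst P (shift x y u) p))
    where
    shift : ∀ x y u → y - x ≡ (y + u) - (x + u)
    shift = solve-∀ ring
  +-mono-≤ {x} {u = u} {v} (inj₂ refl) (inj₁ (mk< p)) = inj₁ (mk< (subst P (shift x u v) p))
    where
    shift : ∀ x u v → v - u ≡ (x + v) - (x + u)
    shift = solve-∀ ring
  +-mono-≤ (inj₂ refl) (inj₂ refl) = inj₂ refl

  private
    zero-* : ∀ y → 0# ≡ 0# * y
    zero-* = solve-∀ ring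
    *-zero : ∀ x → 0# ≡ x * 0#
    *-zero = solve-∀ ring
    difference-*ˡ : ∀ c x y → c * (y - x) ≡ c * y - c * x
    difference-*ˡ = solve-∀ ring
    neg-*-neg : ∀ x y → - x * - y ≡ x * y
    neg-*-neg = solve-∀ ring

  *-pos : ∀ {x y} → 0# < x → 0# < y → 0# < x * y
  *-pos 0<x 0<y = positive⇒0< (*-closed (0<⇒positive 0<x) (0<⇒positive 0<y))

  *-nonNeg : ∀ {x y} → 0# ≤ x → 0# ≤ y → 0# ≤ x * y
  *-nonNeg (inj₁ 0<x) (inj₁ 0<y) = inj₁ (*-pos 0<x 0<y)
  *-nonNeg {x} (inj₁ _) (inj₂ refl) = inj₂ (*-zero x)
  *-nonNeg {y = y} (inj₂ refl) _ = inj₂ (zero-* y)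

  *-monoˡ-< : ∀ {c x y} → 0# < c → x < y → c * x < c * y
  *-monoˡ-< {c} {x} {y} 0<c (mk< p) = mk< (subst P (difference-*ˡ c x y) (*-closed (0<⇒positive 0<c) p))

  *-monoˡ-≤ : ∀ {c x y} → 0# ≤ c → x ≤ y → c * x ≤ c * y
  *-monoˡ-≤ (inj₁ 0<c) (inj₁ x<y) = inj₁ (*-monoˡ-< 0<c x<y)
  *-monoˡ-≤ _ (inj₂ refl) = inj₂ refl
  *-monoˡ-≤ {x = x} {y} (inj₂ refl) (inj₁ _) = inj₂ (trans (sym (zero-* x)) (zero-* y))

  *-monoʳ-< : ∀ {c x y} → 0# < c → x < y → x * c < y * c
  *-monoʳ-< {c} {x} {y} 0<c x<y = subst₂ _<_ (*-comm c x) (*-comm c y) (*-monoˡ-< 0<c x<y)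

  *-monoʳ-≤ : ∀ {c x y} → 0# ≤ c → x ≤ y → x * c ≤ y * c
  *-monoʳ-≤ {c} {x} {y} 0≤c x≤y = subst₂ _≤_ (*-comm c x) (*-comm c y) (*-monoˡ-≤ 0≤c x≤y)

  *-cancelˡ-< : ∀ {c x y} → 0# < c → c * x < c * y → x < y
  *-cancelˡ-< {c} {x} {y} 0<c cx<cy with <-cmp x y
  ... | inj₁ x<y = x<y
  ... | inj₂ (inj₁ y<x) = ⊥-elim (<-asym cx<cy (*-monoˡ-< 0<c y<x))
  ... | inj₂ (inj₂ refl) = ⊥-elim (<-irrefl cx<cy)

  square-nonNeg : ∀ x → 0# ≤ x * x
  square-nonNeg x with trichotomy x
  ... | inj₁ p = inj₁ (positive⇒0< (*-closed p p))
  ... | inj₂ (inj₁ q) = inj₁ (positive⇒0< (subst P (neg-*-neg x x) (*-closed q q)))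
  ... | inj₂ (inj₂ refl) = inj₂ refl

  square-pos : ∀ {x} → x ≢ 0# → 0# < x * x
  square-pos {x} x≢0 with square-nonNeg x
  ... | inj₁ 0<x² = 0<x²
  ... | inj₂ 0≡x² with trichotomy x
  ...   | inj₁ p = ⊥-elim (¬positive-0# (subst P (sym 0≡x²) (*-closed p p)))
  ...   | inj₂ (inj₁ q) = ⊥-elim (¬positive-0# (subst P (trans (neg-*-neg x x) (sym 0≡x²)) (*-closed q q)))
  ...   | inj₂ (inj₂ x≡0) = ⊥-elim (x≢0 x≡0)

  *-≢0 : ∀ {x y} → x ≢ 0# → y ≢ 0# → x * y ≢ 0#
  *-≢0 {x} {y} x≢0 y≢0 xy≡0 = <-irrefl (subst (0# <_) (trans (rearrange x y) (cong (λ z → z * z) xy≡0)) 0<x²y²)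
    where
    rearrange : ∀ x y → x * x * (y * y) ≡ (x * y) * (x * y)
    rearrange = solve-∀ ring
    0<x²y² : 0# < x * x * (y * y)
    0<x²y² = *-pos (square-pos x≢0) (square-pos y≢0)

  positive-1# : P 1#
  positive-1# with trichotomy 1#
  ... | inj₁ p = p
  ... | inj₂ (inj₁ q) = *-closed q q
  ... | inj₂ (inj₂ ())

  positive-ι : ∀ {k} → 0ℤ ℤ.< k → P (ι k)
  positive-ι {+ 0} (+<+ ())
  positive-ι {+[1+ n ]} _ = go n
    where
    go : ∀ n → P (ι +[1+ n ])
    go zero = positive-1#
    go (suc n) = +-closed positive-1# (go n)

  ι-mono-< : ∀ {a b} → a ℤ.< b → ι a < ι b
  ι-mono-< a<b = mk< (positive-ι (IntegerFacts.<⇒0<- a<b))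

  ι-mono-≤ : ∀ {a b} → a ℤ.≤ b → ι a ≤ ι b
  ι-mono-≤ {a} {b} a≤b with a ℤ.≟ b
  ... | yes refl = inj₂ refl
  ... | no a≢b = inj₁ (ι-mono-< (ℤₚ.≤∧≢⇒< a≤b a≢b))

  ι-cancel-< : ∀ {a b} → ι a < ι b → a ℤ.< b
  ι-cancel-< {a} {b} ιa<ιb with ℤₚ.<-cmp a b
  ... | tri< a<b _ _ = a<b
  ... | tri≈ _ refl _ = ⊥-elim (<-irrefl ιa<ιb)
  ... | tri> _ _ b<a = ⊥-elim (<-asym ιa<ιb (ι-mono-< b<a))

  ≤⇒0≤- : ∀ {x y} → x ≤ y → 0# ≤ y - x
  ≤⇒0≤- (inj₁ (mk< p)) = inj₁ (positive⇒0< p)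
  ≤⇒0≤- {x} (inj₂ refl) = inj₂ (sym (difference-self x))

  ≤-by-difference : ∀ {x y z} → y - x ≡ z → 0# ≤ z → x ≤ y
  ≤-by-difference y-x≡z (inj₁ 0<z) = inj₁ (<-by-difference y-x≡z 0<z)
  ≤-by-difference {x} {y} y-x≡z (inj₂ 0≡z) with <-cmp x y
  ... | inj₁ x<y = inj₁ x<y
  ... | inj₂ (inj₂ x≡y) = inj₂ x≡y
  ... | inj₂ (inj₁ (mk< p)) =
    ⊥-elim (¬positive-0# (subst P (trans (sym (difference-neg x y)) (cong -_ (trans y-x≡z (sym 0≡z)))) p))

  x<x+y : ∀ {x y} → 0# < y → x < x + y
  x<x+y {x} {y} = <-by-difference (cancel x y)
    where
    cancel : ∀ x y → x + y - x ≡ y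
    cancel = solve-∀ ring

  square-mono : ∀ {x y} → 0# ≤ x → x ≤ y → x * x ≤ y * y
  square-mono {x} {y} 0≤x x≤y =
    ≤-trans (*-monoˡ-≤ 0≤x x≤y) (subst (_≤ y * y) (*-comm y x) (*-monoˡ-≤ (≤-trans 0≤x x≤y) x≤y))

  ≤-*-self : ∀ {c x} → 1# ≤ c → 0# ≤ x → x ≤ c * x
  ≤-*-self {c} {x} 1≤c 0≤x = ≤-by-difference (scale c x) (*-nonNeg (≤⇒0≤- 1≤c) 0≤x)
    where
    scale : ∀ c x → c * x - x ≡ (c - 1#) * x
    scale = solve-∀ ring

  square-of-sum₂ : ∀ x y → (x + y) * (x + y) ≤ 2 * (x * x + y * y)
  square-of-sum₂ x y = ≤-by-difference (expand x y) (square-nonNeg (x - y))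
    where
    expand : ∀ x y → 2 * (x * x + y * y) - (x + y) * (x + y) ≡ (x - y) * (x - y)
    expand = solve-∀ ring

  square-of-sum₃ : ∀ x y z → (x + y + z) * (x + y + z) ≤ 3 * (x * x + y * y + z * z)
  square-of-sum₃ x y z =
    ≤-by-difference (expand x y z) (+-mono-≤ (+-mono-≤ (square-nonNeg (x - y)) (square-nonNeg (y - z))) (square-nonNeg (x - z)))
    where
    expand : ∀ x y z → 3 * (x * x + y * y + z * z) - (x + y + z) * (x + y + z) ≡
             (x - y) * (x - y) + (y - z) * (y - z) + (x - z) * (x - z)
    expand = solve-∀ ring

  Archimedean : Set
  Archimedean = ∀ {z} → 0# < z → ∀ w → ∃[ n ] (1 ℕ.≤ n × w < ι (+ n) * z)

  -- If every element lies below a positive integer and every nonzero element divides a positive integer,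
  -- then z > 0 has an integer multiple U z > 1, and a multiple of that exceeds any given w.
  archimedean : (∀ w → ∃[ B ] (0ℤ ℤ.< B × w < ι B)) →
                (∀ {z} → z ≢ 0# → ∃[ u ] ∃[ k ] (0ℤ ℤ.< k × z * u ≡ ι k)) →
                Archimedean
  archimedean bounded divides-integer {z} 0<z w with divides-integer {z} (λ { refl → <-irrefl 0<z })
  ... | u , k , 0<k , zu≡k with bounded u | bounded w
  ...   | U , 0<U , u<U | V , 0<V , w<V = ℤ.∣ V ℤ.* U ∣ , 1≤n , w<nz
    where
    0<VU : 0ℤ ℤ.< V ℤ.* U
    0<VU = IntegerFacts.*-pos 0<V 0<U
    1≤n : 1 ℕ.≤ ℤ.∣ V ℤ.* U ∣
    1≤n = IntegerFacts.0<⇒1≤∣∣ 0<VU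
    1<zU : 1# < z * ι U
    1<zU = ≤-<-trans (ι-mono-≤ (IntegerFacts.0<⇒1≤ 0<k)) (subst (_< z * ι U) zu≡k (*-monoˡ-< {z} 0<z u<U))
    V<VzU : ι V < ι V * (z * ι U)
    V<VzU = subst (_< ι V * (z * ι U)) (*-identityʳ (ι V)) (*-monoˡ-< (positive⇒0< (positive-ι 0<V)) 1<zU)
    w<nz : w < ι (+ ℤ.∣ V ℤ.* U ∣) * z
    w<nz = subst (w <_) (begin
      ι V * (z * ι U)          ≡⟨ rearrange (ι V) z (ι U) ⟩
      ι V * ι U * z            ≡⟨ cong (_* z) (ι-* V U) ⟨
      ι (V ℤ.* U) * z          ≡⟨ cong (λ k → ι k * z) (ℤₚ.0≤i⇒+∣i∣≡i (ℤₚ.<⇒≤ 0<VU)) ⟨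
      ι (+ ℤ.∣ V ℤ.* U ∣) * z  ∎) (<-trans w<V V<VzU)
      where
      open ≡-Reasoning
      rearrange : ∀ v z u → v * (z * u) ≡ v * u * z
      rearrange = solve-∀ ring

  unbounded-growth : Archimedean → ∀ {g} → 0# < g → (v : ℕ → ℤ[√ D ]) → 0# < v 0 →
                     (∀ k → 4 * v (suc k) ≡ (4 + g) * v k) → ∀ M → ∃[ k ] M < v k
  unbounded-growth arch {g} 0<g v 0<v₀ step M =
    k , *-cancelˡ-< {4} {M} {v k} 0<4 (<-≤-trans 4M<kgv₀ (proj₂ (linear-lower-bound k)))
    where
    k = proj₁ (arch (*-pos 0<g 0<v₀) (4 * M))
    4M<kgv₀ : 4 * M < ι (+ k) * (g * v 0)
    4M<kgv₀ = proj₂ (proj₂ (arch (*-pos 0<g 0<v₀) (4 * M)))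
    0<4 : 0# < 4
    0<4 = positive⇒0< (positive-ι (+<+ (s≤s z≤n)))
    split : ∀ g v → (4 + g) * v ≡ 4 * v + g * v
    split = solve-∀ ring
    succ-* : ∀ a x → (1# + a) * x ≡ a * x + x
    succ-* = solve-∀ ring
    linear-lower-bound : ∀ k → v 0 ≤ v k × ι (+ k) * (g * v 0) ≤ 4 * v k
    linear-lower-bound zero = inj₂ refl , inj₁ (subst (_< 4 * v 0) (zero-* (g * v 0)) (*-pos 0<4 0<v₀))
    linear-lower-bound (suc k) with linear-lower-bound k
    ... | v₀≤vₖ , kgv₀≤4vₖ = ≤-trans v₀≤vₖ (inj₁ vₖ<vₖ₊₁) , subst (ι (+ suc k) * (g * v 0) ≤_) 4vₖ₊₁ grow
      where
      4vₖ₊₁ : 4 * v k + g * v k ≡ 4 * v (suc k)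
      4vₖ₊₁ = trans (sym (split g (v k))) (sym (step k))
      vₖ<vₖ₊₁ : v k < v (suc k)
      vₖ<vₖ₊₁ = *-cancelˡ-< 0<4 (subst (4 * v k <_) 4vₖ₊₁ (x<x+y (*-pos 0<g (<-≤-trans 0<v₀ v₀≤vₖ))))
      grow : ι (+ suc k) * (g * v 0) ≤ 4 * v k + g * v k
      grow = subst (_≤ 4 * v k + g * v k) (sym (succ-* (ι (+ k)) (g * v 0)))
               (+-mono-≤ kgv₀≤4vₖ (*-monoˡ-≤ (inj₁ 0<g) v₀≤vₖ))

-- The ordering of ℤ[√D] obtained from the embedding √D ↦ s·√D, where s = ±1.
module SignedOrder (D : ℤ) (0<D : 0ℤ ℤ.< D)
                   (irrational : ∀ a b → b ≢ 0ℤ → a ℤ.* a ≢ b ℤ.* b ℤ.* D)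
                   (s : ℤ) (s*s≡1 : s ℤ.* s ≡ 1ℤ) where
  private
    ring : AlmostCommutativeRing 0ℓ 0ℓ
    ring = QuadraticRing.ring D
  open AlmostCommutativeRing ring using (_+_; _*_; -_; 0#) renaming (_-_ to infixl 6 _-_)
  open QuadraticRing D using (ι; conj; norm; *-conj)
  open Positivity D 0<D irrational

  twist : ℤ[√ D ] → ℤ[√ D ]
  twist ⟨ a , b ⟩ = ⟨ a , b ℤ.* s ⟩

  s≢0 : s ≢ 0ℤ
  s≢0 refl = case s*s≡1 of λ ()

  private
    s-square-cancel : ∀ b e → b ℤ.* s ℤ.* (e ℤ.* s) ≡ b ℤ.* e
    s-square-cancel b e = begin
      b ℤ.* s ℤ.* (e ℤ.* s)   ≡⟨ regroup b e s ⟩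
      b ℤ.* e ℤ.* (s ℤ.* s)   ≡⟨ cong (b ℤ.* e ℤ.*_) s*s≡1 ⟩
      b ℤ.* e ℤ.* 1ℤ          ≡⟨ ℤₚ.*-identityʳ (b ℤ.* e) ⟩
      b ℤ.* e                 ∎
      where
      open ≡-Reasoning
      regroup : ∀ b e s → b ℤ.* s ℤ.* (e ℤ.* s) ≡ b ℤ.* e ℤ.* (s ℤ.* s)
      regroup = ℤ-Solver.solve-∀

  twist-+ : ∀ x y → twist (x + y) ≡ twist x + twist y
  twist-+ ⟨ a , b ⟩ ⟨ c , e ⟩ = ⟨⟩-cong refl (ℤₚ.*-distribʳ-+ s b e)

  twist-* : ∀ x y → twist (x * y) ≡ twist x * twist y
  twist-* ⟨ a , b ⟩ ⟨ c , e ⟩ =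
    ⟨⟩-cong (cong (λ z → a ℤ.* c ℤ.+ z ℤ.* D) (sym (s-square-cancel b e))) (im-identity a b c e s)
    where
    im-identity : ∀ a b c e s → (a ℤ.* e ℤ.+ b ℤ.* c) ℤ.* s ≡ a ℤ.* (e ℤ.* s) ℤ.+ b ℤ.* s ℤ.* c
    im-identity = ℤ-Solver.solve-∀

  twist-neg : ∀ x → twist (- x) ≡ - twist x
  twist-neg ⟨ a , b ⟩ = ⟨⟩-cong refl (sym (ℤₚ.neg-distribˡ-* b s))

  twist-≡0# : ∀ x → twist x ≡ 0# → x ≡ 0#
  twist-≡0# ⟨ a , b ⟩ eq with ℤₚ.i*j≡0⇒i≡0∨j≡0 b (cong im eq)
  ... | inj₁ refl = cong (λ a → ⟨ a , 0ℤ ⟩) (cong re eq)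
  ... | inj₂ s≡0 = ⊥-elim (s≢0 s≡0)

  SignedPositive : ℤ[√ D ] → Set
  SignedPositive x = Positive (twist x)

  cone : Cone.IsPositiveCone D SignedPositive
  cone = record
    { +-closed = λ {x} {y} px py → subst Positive (sym (twist-+ x y)) (positive-+ px py)
    ; *-closed = λ {x} {y} px py → subst Positive (sym (twist-* x y)) (positive-* px py)
    ; asym = λ {x} px p-x → positive-asym px (subst Positive (twist-neg x) p-x)
    ; trichotomy = trichotomy
    }
    where
    trichotomy : ∀ x → SignedPositive x ⊎ SignedPositive (- x) ⊎ x ≡ 0#
    trichotomy x with positive-trichotomy (twist x)
    ... | inj₁ p = inj₁ p
    ... | inj₂ (inj₁ q) = inj₂ (inj₁ (subst Positive (sym (twist-neg x)) q))
    ... | inj₂ (inj₂ eq) = inj₂ (inj₂ (twist-≡0# x eq))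

  open Ordered D SignedPositive cone public

  positive-coordinates : ∀ {v b} → 0ℤ ℤ.< v → b ℤ.* b ℤ.* D ℤ.< v ℤ.* v → 0# < ⟨ v , b ⟩
  positive-coordinates {v} {b} 0<v b²D<v² =
    positive⇒0< (inj₁ (0<v , subst (λ z → z ℤ.* D ℤ.< v ℤ.* v) (sym (s-square-cancel b b)) b²D<v²))

  bounded-by-integer : ∀ w → ∃[ B ] (0ℤ ℤ.< B × w < ι B)
  bounded-by-integer ⟨ a , b ⟩ = + ℤ.∣ a ∣ ℤ.+ E , 0<B , <-by-difference coordinates 0<sum
    where
    E = b ℤ.* b ℤ.* D ℤ.+ 1ℤ
    0≤b²D : 0ℤ ℤ.≤ b ℤ.* b ℤ.* D
    0≤b²D = IntegerFacts.*-nonNeg (IntegerFacts.square-nonNeg b) (ℤₚ.<⇒≤ 0<D)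
    0<E : 0ℤ ℤ.< E
    0<E = ℤₚ.+-mono-≤-< 0≤b²D (+<+ (s≤s z≤n))
    0<B : 0ℤ ℤ.< + ℤ.∣ a ∣ ℤ.+ E
    0<B = ℤₚ.+-mono-≤-< (+≤+ z≤n) 0<E
    expand : ∀ b D → (b ℤ.* b ℤ.* D ℤ.+ 1ℤ) ℤ.* (b ℤ.* b ℤ.* D ℤ.+ 1ℤ) ℤ.- ℤ.- b ℤ.* ℤ.- b ℤ.* D ≡
             b ℤ.* b ℤ.* D ℤ.* (b ℤ.* b ℤ.* D) ℤ.+ b ℤ.* b ℤ.* D ℤ.+ 1ℤ
    expand = ℤ-Solver.solve-∀
    0<⟨E,-b⟩ : 0# < ⟨ E , ℤ.- b ⟩
    0<⟨E,-b⟩ = positive-coordinates 0<E (IntegerFacts.0<-⇒< (expand b D)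
                 (ℤₚ.+-mono-≤-< (ℤₚ.+-mono-≤ (IntegerFacts.square-nonNeg (b ℤ.* b ℤ.* D)) 0≤b²D) (+<+ (s≤s z≤n))))
    0<sum : 0# < ι (+ ℤ.∣ a ∣ ℤ.- a) + ⟨ E , ℤ.- b ⟩
    0<sum = +-mono-≤-< (ι-mono-≤ (IntegerFacts.∣i∣-i-nonNeg a)) 0<⟨E,-b⟩
    coordinates : ι (+ ℤ.∣ a ∣ ℤ.+ E) - ⟨ a , b ⟩ ≡ ι (+ ℤ.∣ a ∣ ℤ.- a) + ⟨ E , ℤ.- b ⟩
    coordinates = ⟨⟩-cong (re-identity (+ ℤ.∣ a ∣) a E) refl
      where
      re-identity : ∀ x a e → x ℤ.+ e ℤ.- a ≡ x ℤ.- a ℤ.+ e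
      re-identity = ℤ-Solver.solve-∀

  norm≢0 : ∀ {z} → z ≢ 0# → norm z ≢ 0ℤ
  norm≢0 {⟨ a , b ⟩} z≢0 N≡0 with b ℤ.≟ 0ℤ
  ... | no b≢0 = irrational a b b≢0 (ℤₚ.i-j≡0⇒i≡j (a ℤ.* a) (b ℤ.* b ℤ.* D) N≡0)
  ... | yes refl with ℤₚ.i*j≡0⇒i≡0∨j≡0 a (trans (sym (ℤₚ.+-identityʳ (a ℤ.* a))) N≡0)
  ...   | inj₁ refl = z≢0 refl
  ...   | inj₂ refl = z≢0 refl

  divides-positive-integer : ∀ {z} → z ≢ 0# → ∃[ u ] ∃[ k ] (0ℤ ℤ.< k × z * u ≡ ι k)
  divides-positive-integer {z} z≢0 with ℤₚ.<-cmp 0ℤ (norm z)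
  ... | tri< 0<N _ _ = conj z , norm z , 0<N , *-conj z
  ... | tri≈ _ 0≡N _ = ⊥-elim (norm≢0 z≢0 (sym 0≡N))
  ... | tri> _ _ N<0 = - conj z , ℤ.- norm z , ℤₚ.neg-mono-< N<0 , trans (neg-*ʳ z (conj z)) (cong -_ (*-conj z))
    where
    neg-*ʳ : ∀ x y → x * - y ≡ - (x * y)
    neg-*ʳ = solve-∀ ring

  -- Opaque, so that conversion checking never evaluates the witnesses it produces.
  opaque
    archimedean-property : Archimedean
    archimedean-property = archimedean bounded-by-integer divides-positive-integer

module Beatty (t d s : ℤ) (s≡±1 : s ≡ 1ℤ ⊎ s ≡ -1ℤ) (0<D : 0ℤ ℤ.< disc t d)
              (nonsquare : ∀ k → ¬ (k ℤ.* k ≡ disc t d)) where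

  D : ℤ
  D = disc t d

  private
    +∣D∣≡D : + ℤ.∣ D ∣ ≡ D
    +∣D∣≡D = ℤₚ.0≤i⇒+∣i∣≡i (ℤₚ.<⇒≤ 0<D)

    irrational : ∀ a b → b ≢ 0ℤ → a ℤ.* a ≢ b ℤ.* b ℤ.* D
    irrational a b b≢0 = subst (λ E → a ℤ.* a ≢ b ℤ.* b ℤ.* E) +∣D∣≡D
      (nonsquare⇒irrational (λ k → subst (λ E → k ℤ.* k ≢ E) (sym +∣D∣≡D) (nonsquare k)) a b b≢0)

    s*s≡1 : s ℤ.* s ≡ 1ℤ
    s*s≡1 = unit-square s≡±1
      where
      unit-square : ∀ {u} → u ≡ 1ℤ ⊎ u ≡ -1ℤ → u ℤ.* u ≡ 1ℤ
      unit-square (inj₁ refl) = refl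
      unit-square (inj₂ refl) = refl

    ring : AlmostCommutativeRing 0ℓ 0ℓ
    ring = QuadraticRing.ring D

  open AlmostCommutativeRing ring using (_+_; _*_; -_; 0#; 1#) renaming (_-_ to infixl 6 _-_)
  open QuadraticRing D using (ι; ι-*)
  open SignedOrder D 0<D irrational s s*s≡1 public

  -- τ = 2α and τ̄ = 2ᾱ, where α = (t + s√D)/2 is the root of x² − t x + d of the statement.
  τ τ̄ : ℤ[√ D ]
  τ = ⟨ t , 1ℤ ⟩
  τ̄ = ⟨ t , -1ℤ ⟩

  F : ℤ → ℤ
  F = floorMulα t d s

  private
    im-ι*τ : ∀ m → im (ι m * τ) ≡ m
    im-ι*τ m = identity m t
      where
      identity : ∀ m t → m ℤ.* 1ℤ ℤ.+ 0ℤ ℤ.* t ≡ m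
      identity = ℤ-Solver.solve-∀

    ι*τ≢ι : ∀ {m k} → m ≢ 0ℤ → ι m * τ ≢ ι k
    ι*τ≢ι {m} m≢0 eq = m≢0 (trans (sym (im-ι*τ m)) (cong im eq))

  LeMulα⇔< : ∀ {k m} → m ≢ 0ℤ → LeMulα t d s k m ⇔ ι (+ 2 ℤ.* k) < ι m * τ
  LeMulα⇔< {k} {m} m≢0 = mk⇔ to from
    where
    coordinates : ι m * τ - ι (+ 2 ℤ.* k) ≡ ⟨ m ℤ.* t ℤ.- + 2 ℤ.* k , m ⟩
    coordinates = ⟨⟩-cong (re-identity m t k D) (im-identity m t)
      where
      re-identity : ∀ m t k D → m ℤ.* t ℤ.+ 0ℤ ℤ.* 1ℤ ℤ.* D ℤ.+ ℤ.- (+ 2 ℤ.* k) ≡ m ℤ.* t ℤ.- + 2 ℤ.* k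
      re-identity = ℤ-Solver.solve-∀
      im-identity : ∀ m t → m ℤ.* 1ℤ ℤ.+ 0ℤ ℤ.* t ℤ.+ ℤ.- 0ℤ ≡ m
      im-identity = ℤ-Solver.solve-∀
    to : LeMulα t d s k m → ι (+ 2 ℤ.* k) < ι m * τ
    to (inj₁ p) = mk< (subst SignedPositive (sym coordinates) p)
    to (inj₂ (_ , m*s≡0)) = ⊥-elim ([ m≢0 , s≢0 ]′ (ℤₚ.i*j≡0⇒i≡0∨j≡0 m m*s≡0))
    from : ι (+ 2 ℤ.* k) < ι m * τ → LeMulα t d s k m
    from (mk< p) = inj₁ (subst SignedPositive coordinates p)

  findFloor-spec : ∀ f m k → LeMulα t d s (k ℤ.- + f) m → ¬ LeMulα t d s (k ℤ.+ 1ℤ) m →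
                   let r = findFloor t d s (suc f) m k in LeMulα t d s r m × ¬ LeMulα t d s (r ℤ.+ 1ℤ) m
  findFloor-spec f m k below above with nonNeg? D (m ℤ.* t ℤ.- + 2 ℤ.* k) (m ℤ.* s)
  ... | yes k≤mα = k≤mα , above
  findFloor-spec zero m k below above | no k≰mα = ⊥-elim (k≰mα (subst (λ j → LeMulα t d s j m) (ℤₚ.+-identityʳ k) below))
  findFloor-spec (suc f) m k below above | no k≰mα =
    findFloor-spec f m (k ℤ.- 1ℤ) (subst (λ j → LeMulα t d s j m) (shift k (+ f)) below)
                                  (subst (λ j → ¬ LeMulα t d s j m) (sym (unshift k)) k≰mα)
    where
    shift : ∀ k f → k ℤ.- (1ℤ ℤ.+ f) ≡ k ℤ.- 1ℤ ℤ.- f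
    shift = ℤ-Solver.solve-∀
    unshift : ∀ k → k ℤ.- 1ℤ ℤ.+ 1ℤ ≡ k
    unshift = ℤ-Solver.solve-∀

  private
    σ : ℤ[√ D ]
    σ = ⟨ 0ℤ , 1ℤ ⟩

    τ≡t+σ : τ ≡ ι t + σ
    τ≡t+σ = ⟨⟩-cong (sym (ℤₚ.+-identityʳ t)) refl

    1<D : 1ℤ ℤ.< D
    1<D with ℤₚ.<-cmp 1ℤ D
    ... | tri< 1<D _ _ = 1<D
    ... | tri≈ _ 1≡D _ = ⊥-elim (nonsquare 1ℤ 1≡D)
    ... | tri> _ _ D<1 = ⊥-elim (ℤₚ.<⇒≱ D<1 (IntegerFacts.0<⇒1≤ 0<D))

    D±σ-pos : ∀ {e} → e ℤ.* e ≡ 1ℤ → 0# < ⟨ D , e ⟩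
    D±σ-pos {e} e²≡1 = positive-coordinates 0<D (IntegerFacts.0<-⇒< identity (IntegerFacts.*-pos 0<D (IntegerFacts.<⇒0<- 1<D)))
      where
      identity : D ℤ.* D ℤ.- e ℤ.* e ℤ.* D ≡ D ℤ.* (D ℤ.- 1ℤ)
      identity = begin
        D ℤ.* D ℤ.- e ℤ.* e ℤ.* D  ≡⟨ cong (λ u → D ℤ.* D ℤ.- u ℤ.* D) e²≡1 ⟩
        D ℤ.* D ℤ.- 1ℤ ℤ.* D      ≡⟨ factor D ⟩
        D ℤ.* (D ℤ.- 1ℤ)           ∎
        where
        open ≡-Reasoning
        factor : ∀ D → D ℤ.* D ℤ.- 1ℤ ℤ.* D ≡ D ℤ.* (D ℤ.- 1ℤ)
        factor = ℤ-Solver.solve-∀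

    0<D-σ : 0# < ι D - σ
    0<D-σ = subst (0# <_) (⟨⟩-cong (sym (ℤₚ.+-identityʳ D)) refl) (D±σ-pos { -1ℤ} refl)

    0<D+σ : 0# < ι D + σ
    0<D+σ = subst (0# <_) (⟨⟩-cong (sym (ℤₚ.+-identityʳ D)) refl) (D±σ-pos {1ℤ} refl)

  -- The floor is searched for in [−B, B], B = n(|t| + |D|), since |nα| ≤ B.
  search-range : ∀ n → 1 ℕ.≤ n → let B = n ℕ.* (ℤ.∣ t ∣ ℕ.+ ℤ.∣ D ∣) in
                 LeMulα t d s (+ B ℤ.- + (2 ℕ.* B)) (+ n) × ¬ LeMulα t d s (+ B ℤ.+ 1ℤ) (+ n)
  search-range n@(suc _) _ =
    Equivalence.from (LeMulα⇔< {+ B ℤ.- + (2 ℕ.* B)} {+ n} (λ ())) lower ,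
    <-asym upper ∘ Equivalence.to (LeMulα⇔< {+ B ℤ.+ 1ℤ} {+ n} (λ ()))
    where
    B = n ℕ.* (ℤ.∣ t ∣ ℕ.+ ℤ.∣ D ∣)
    N = ι (+ n)
    T = ι t
    ∣T∣ = ι (+ ℤ.∣ t ∣)
    X = N * (∣T∣ + ι D)
    ι-B : ι (+ B) ≡ X
    ι-B = begin
      ι (+ B)                              ≡⟨ cong ι (ℤₚ.pos-* n (ℤ.∣ t ∣ ℕ.+ ℤ.∣ D ∣)) ⟩
      ι (+ n ℤ.* + (ℤ.∣ t ∣ ℕ.+ ℤ.∣ D ∣))   ≡⟨ cong (λ x → ι (+ n ℤ.* x)) (trans (ℤₚ.pos-+ ℤ.∣ t ∣ ℤ.∣ D ∣) (cong (λ x → + ℤ.∣ t ∣ ℤ.+ x) +∣D∣≡D)) ⟩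
      ι (+ n ℤ.* (+ ℤ.∣ t ∣ ℤ.+ D))         ≡⟨ ι-* (+ n) (+ ℤ.∣ t ∣ ℤ.+ D) ⟩
      X                                    ∎
      where open ≡-Reasoning
    0<N : 0# < N
    0<N = ι-mono-< (+<+ (s≤s z≤n))
    0≤∣T∣ : 0# ≤ ∣T∣
    0≤∣T∣ = ι-mono-≤ (+≤+ z≤n)
    0<ιD : 0# < ι D
    0<ιD = ι-mono-< 0<D
    0<2 : 0# < 2
    0<2 = ι-mono-< (+<+ (s≤s z≤n))
    lower : ι (+ 2 ℤ.* (+ B ℤ.- + (2 ℕ.* B))) < N * τ
    lower = <-by-difference difference (*-pos 0<N sum-pos)
      where
      sum-pos : 0# < ∣T∣ + T + ∣T∣ + ι D + (ι D + σ)
      sum-pos = +-mono-≤-< (+-mono-≤ (+-mono-≤ (ι-mono-≤ (IntegerFacts.∣i∣+i-nonNeg t)) 0≤∣T∣) (inj₁ 0<ιD)) 0<D+σ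
      identity : ∀ N T σ ∣T∣ D → N * (T + σ) - 2 * (N * (∣T∣ + D) - 2 * (N * (∣T∣ + D))) ≡ N * (∣T∣ + T + ∣T∣ + D + (D + σ))
      identity = solve-∀ ring
      difference : N * τ - ι (+ 2 ℤ.* (+ B ℤ.- + (2 ℕ.* B))) ≡ N * (∣T∣ + T + ∣T∣ + ι D + (ι D + σ))
      difference = begin
        N * τ - ι (+ 2 ℤ.* (+ B ℤ.- + (2 ℕ.* B)))  ≡⟨ cong₂ (λ x y → N * x - y) τ≡t+σ (ι-* (+ 2) (+ B ℤ.- + (2 ℕ.* B))) ⟩
        N * (T + σ) - 2 * (ι (+ B) - ι (+ (2 ℕ.* B)))  ≡⟨ cong (λ y → N * (T + σ) - 2 * (ι (+ B) - y)) (trans (cong ι (ℤₚ.pos-* 2 B)) (ι-* (+ 2) (+ B))) ⟩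
        N * (T + σ) - 2 * (ι (+ B) - 2 * ι (+ B))     ≡⟨ cong (λ x → N * (T + σ) - 2 * (x - 2 * x)) ι-B ⟩
        N * (T + σ) - 2 * (X - 2 * X)                 ≡⟨ identity N T σ ∣T∣ (ι D) ⟩
        N * (∣T∣ + T + ∣T∣ + ι D + (ι D + σ))          ∎
        where open ≡-Reasoning
    upper : N * τ < ι (+ 2 ℤ.* (+ B ℤ.+ 1ℤ))
    upper = <-by-difference difference (+-mono-< (*-pos 0<N sum-pos) 0<2)
      where
      sum-pos : 0# < ∣T∣ - T + ∣T∣ + ι D + (ι D - σ)
      sum-pos = +-mono-≤-< (+-mono-≤ (+-mono-≤ (ι-mono-≤ (IntegerFacts.∣i∣-i-nonNeg t)) 0≤∣T∣) (inj₁ 0<ιD)) 0<D-σ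
      identity : ∀ N T σ ∣T∣ D → 2 * (N * (∣T∣ + D) + 1#) - N * (T + σ) ≡ N * (∣T∣ - T + ∣T∣ + D + (D - σ)) + 2
      identity = solve-∀ ring
      difference : ι (+ 2 ℤ.* (+ B ℤ.+ 1ℤ)) - N * τ ≡ N * (∣T∣ - T + ∣T∣ + ι D + (ι D - σ)) + 2
      difference = begin
        ι (+ 2 ℤ.* (+ B ℤ.+ 1ℤ)) - N * τ   ≡⟨ cong₂ (λ x y → x - N * y) (ι-* (+ 2) (+ B ℤ.+ 1ℤ)) τ≡t+σ ⟩
        2 * (ι (+ B) + 1#) - N * (T + σ)    ≡⟨ cong (λ x → 2 * (x + 1#) - N * (T + σ)) ι-B ⟩
        2 * (X + 1#) - N * (T + σ)          ≡⟨ identity N T σ ∣T∣ (ι D) ⟩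
        N * (∣T∣ - T + ∣T∣ + ι D + (ι D - σ)) + 2  ∎
        where open ≡-Reasoning

  floor-spec : ∀ {m} → 0ℤ ℤ.< m → ι (+ 2 ℤ.* F m) < ι m * τ × ι m * τ < ι (+ 2 ℤ.* F m) + 2
  floor-spec {m} 0<m = subst (λ m → ι (+ 2 ℤ.* F m) < ι m * τ × ι m * τ < ι (+ 2 ℤ.* F m) + 2)
                             (ℤₚ.0≤i⇒+∣i∣≡i (ℤₚ.<⇒≤ 0<m)) (spec ℤ.∣ m ∣ (IntegerFacts.0<⇒1≤∣∣ 0<m))
    where
    double-succ : ∀ f → + 2 ℤ.* (f ℤ.+ 1ℤ) ≡ + 2 ℤ.* f ℤ.+ + 2
    double-succ = ℤ-Solver.solve-∀
    spec : ∀ n → 1 ℕ.≤ n → ι (+ 2 ℤ.* F (+ n)) < ι (+ n) * τ × ι (+ n) * τ < ι (+ 2 ℤ.* F (+ n)) + 2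
    spec n@(suc _) 1≤n =
      Equivalence.to (LeMulα⇔< {F (+ n)} {+ n} (λ ())) (proj₁ found) ,
      subst (ι (+ n) * τ <_) (cong ι (double-succ (F (+ n))))
            (≤∧≢⇒< (≮⇒≥ (proj₂ found ∘ Equivalence.from (LeMulα⇔< {F (+ n) ℤ.+ 1ℤ} {+ n} (λ ())))) (ι*τ≢ι {+ n} (λ ())))
      where
      B = n ℕ.* (ℤ.∣ t ∣ ℕ.+ ℤ.∣ D ∣)
      found = findFloor-spec (2 ℕ.* B) (+ n) (+ B) (proj₁ (search-range n 1≤n)) (proj₂ (search-range n 1≤n))

  floor-unique : ∀ {m k} → 0ℤ ℤ.< m → ι (+ 2 ℤ.* k) < ι m * τ → ι m * τ < ι (+ 2 ℤ.* k) + 2 → F m ≡ k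
  floor-unique 0<m 2k<mτ mτ<2k+2 =
    ℤₚ.≤-antisym (IntegerFacts.2*<2*+2⇒≤ (ι-cancel-< (<-trans (proj₁ (floor-spec 0<m)) mτ<2k+2)))
                 (IntegerFacts.2*<2*+2⇒≤ (ι-cancel-< (<-trans 2k<mτ (proj₂ (floor-spec 0<m)))))

  -- frac₂ m = 2{mα}.
  frac₂ : ℤ → ℤ[√ D ]
  frac₂ m = ι m * τ - ι (+ 2 ℤ.* F m)

  frac₂-bounds : ∀ {m} → 0ℤ ℤ.< m → 0# < frac₂ m × frac₂ m < 2
  frac₂-bounds {m} 0<m =
    positive⇒0< (positive (proj₁ (floor-spec 0<m))) ,
    mk< (subst SignedPositive (identity (ι (+ 2 ℤ.* F m)) (ι m * τ)) (positive (proj₂ (floor-spec 0<m))))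
    where
    identity : ∀ x y → x + 2 - y ≡ 2 - (y - x)
    identity = solve-∀ ring

  private
    τ+τ̄ : τ + τ̄ ≡ 2 * ι t
    τ+τ̄ = ⟨⟩-cong (double t D) refl
      where
      double : ∀ t D → t ℤ.+ t ≡ + 2 ℤ.* t ℤ.+ 0ℤ ℤ.* 0ℤ ℤ.* D
      double = ℤ-Solver.solve-∀

    τ*τ̄ : τ * τ̄ ≡ 4 * ι d
    τ*τ̄ = ⟨⟩-cong (product t d) (cancel t d)
      where
      product : ∀ t d → t ℤ.* t ℤ.+ 1ℤ ℤ.* -1ℤ ℤ.* (t ℤ.* t ℤ.- + 4 ℤ.* d) ≡ + 4 ℤ.* d ℤ.+ 0ℤ ℤ.* 0ℤ ℤ.* (t ℤ.* t ℤ.- + 4 ℤ.* d)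
      product = ℤ-Solver.solve-∀
      cancel : ∀ t d → t ℤ.* -1ℤ ℤ.+ 1ℤ ℤ.* t ≡ + 4 ℤ.* 0ℤ ℤ.+ 0ℤ ℤ.* d
      cancel = ℤ-Solver.solve-∀

  -- Since τ² = 2tτ − 4d, the value of aτ near an integer is governed by τ̄ times the fractional part of mτ.
  beatty-identity : ∀ a m k → 2 * (ι a * τ - ι (+ 2 ℤ.* k)) ≡ τ̄ * (ι m * τ - ι (+ 2 ℤ.* a)) + 4 * ι (t ℤ.* a ℤ.- d ℤ.* m ℤ.- k)
  beatty-identity a m k = begin
    2 * (Â * τ - ι (+ 2 ℤ.* k))                                         ≡⟨ cong (λ x → 2 * (Â * τ - x)) (ι-* (+ 2) k) ⟩
    2 * (Â * τ - 2 * K)                                                 ≡⟨ regroup Â M K τ τ̄ ⟩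
    τ̄ * (M * τ - 2 * Â) + Â * (2 * (τ + τ̄)) - M * (τ * τ̄) - 4 * K        ≡⟨ cong₂ (λ x y → τ̄ * (M * τ - 2 * Â) + Â * (2 * x) - M * y - 4 * K) τ+τ̄ τ*τ̄ ⟩
    τ̄ * (M * τ - 2 * Â) + Â * (2 * (2 * T)) - M * (4 * Dd) - 4 * K       ≡⟨ collect Â M K T Dd τ τ̄ ⟩
    τ̄ * (M * τ - 2 * Â) + 4 * (T * Â - Dd * M - K)                       ≡⟨ cong₂ (λ x y → τ̄ * (M * τ - x) + 4 * (y - Dd * M - K)) (ι-* (+ 2) a) (ι-* t a) ⟨
    τ̄ * (M * τ - ι (+ 2 ℤ.* a)) + 4 * (ι (t ℤ.* a) - Dd * M - K)        ≡⟨ cong (λ y → τ̄ * (M * τ - ι (+ 2 ℤ.* a)) + 4 * (ι (t ℤ.* a) - y - K)) (ι-* d m) ⟨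
    τ̄ * (M * τ - ι (+ 2 ℤ.* a)) + 4 * ι (t ℤ.* a ℤ.- d ℤ.* m ℤ.- k)     ∎
    where
    open ≡-Reasoning
    Â = ι a
    M = ι m
    K = ι k
    T = ι t
    Dd = ι d
    regroup : ∀ Â M K τ τ̄ → 2 * (Â * τ - 2 * K) ≡ τ̄ * (M * τ - 2 * Â) + Â * (2 * (τ + τ̄)) - M * (τ * τ̄) - 4 * K
    regroup = solve-∀ ring
    collect : ∀ Â M K T Dd τ τ̄ → τ̄ * (M * τ - 2 * Â) + Â * (2 * (2 * T)) - M * (4 * Dd) - 4 * K ≡ τ̄ * (M * τ - 2 * Â) + 4 * (T * Â - Dd * M - K)
    collect = solve-∀ ring

module GeneralizedBeatty (t d s : ℤ) (s≡±1 : s ≡ 1ℤ ⊎ s ≡ -1ℤ) (0<D : 0ℤ ℤ.< disc t d)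
                         (nonsquare : ∀ k → ¬ (k ℤ.* k ≡ disc t d)) (α>1 : AlphaGt1 t d s) where
  open Beatty t d s s≡±1 0<D nonsquare

  private
    ring : AlmostCommutativeRing 0ℓ 0ℓ
    ring = QuadraticRing.ring D

  open AlmostCommutativeRing ring using (_+_; _*_; -_; 0#; *-comm) renaming (_-_ to infixl 6 _-_)
  open QuadraticRing D using (ι; ι-*)

  private
    0<2 : 0# < 2
    0<2 = ι-mono-< (+<+ (s≤s z≤n))

    frac₂-bounds′ : ∀ {n} → 1 ℕ.≤ n → 0# < frac₂ (+ n) × frac₂ (+ n) < 2
    frac₂-bounds′ 1≤n = frac₂-bounds (+<+ 1≤n)

    τ̄≢0 : τ̄ ≢ 0#
    τ̄≢0 τ̄≡0 = case cong im τ̄≡0 of λ ()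

  2<τ : 2 < τ
  2<τ = mk< (subst (Pos D (t ℤ.- + 2)) (sym (ℤₚ.*-identityˡ s)) α>1)

  F-≥ : ∀ {m} → 0ℤ ℤ.< m → m ℤ.≤ F m
  F-≥ {m} 0<m = IntegerFacts.2*<2*+2⇒≤ (ι-cancel-< (<-trans 2m<mτ (proj₂ (floor-spec 0<m))))
    where
    2m<mτ : ι (+ 2 ℤ.* m) < ι m * τ
    2m<mτ = subst (_< ι m * τ) (trans (*-comm (ι m) 2) (sym (ι-* (+ 2) m))) (*-monoˡ-< (ι-mono-< 0<m) 2<τ)

  A-pos : ∀ {n} → 1 ℕ.≤ n → 0ℤ ℤ.< A t d s n
  A-pos {n@(suc _)} _ = ℤₚ.<-≤-trans (+<+ (s≤s z≤n)) (F-≥ (+<+ (s≤s z≤n)))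

  ConjAbsLt1⇔ : ConjAbsLt1 t d s ⇔ (- 2 < τ̄ × τ̄ < 2)
  ConjAbsLt1⇔ = mk⇔ (λ (p , q) → mk< (to-right q) , mk< (to-left p)) (λ (mk< p , mk< q) → from-left q , from-right p)
    where
    -1*s≡-s : -1ℤ ℤ.* s ≡ ℤ.- s
    -1*s≡-s = ℤₚ.-1*i≡-i s
    to-left = subst (Pos D (+ 2 ℤ.- t)) (sym (ℤₚ.*-identityˡ s))
    from-left = subst (Pos D (+ 2 ℤ.- t)) (ℤₚ.*-identityˡ s)
    to-right = subst (Pos D (t ℤ.+ + 2)) (sym -1*s≡-s)
    from-right = subst (Pos D (t ℤ.+ + 2)) -1*s≡-s

  twice-frac-at-A : ∀ r n → 2 * (ι (A t d s n) * τ - ι (+ 2 ℤ.* (t ℤ.* A t d s n ℤ.+ ℤ.- d ℤ.* + n ℤ.+ r))) ≡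
                            τ̄ * frac₂ (+ n) - 4 * ι r
  twice-frac-at-A r n = begin
    2 * (ι a * τ - ι (+ 2 ℤ.* k))              ≡⟨ beatty-identity a (+ n) k ⟩
    y + 4 * ι (t ℤ.* a ℤ.- d ℤ.* + n ℤ.- k)    ≡⟨ cong (λ z → y + 4 * ι z) (deviation t a d (+ n) r) ⟩
    y + 4 * - ι r                              ≡⟨ negate y (ι r) ⟩
    y - 4 * ι r                                ∎
    where
    open ≡-Reasoning
    a = A t d s n
    k = t ℤ.* a ℤ.+ ℤ.- d ℤ.* + n ℤ.+ r
    y = τ̄ * frac₂ (+ n)
    deviation : ∀ t a d n r → t ℤ.* a ℤ.- d ℤ.* n ℤ.- (t ℤ.* a ℤ.+ ℤ.- d ℤ.* n ℤ.+ r) ≡ ℤ.- r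
    deviation = ℤ-Solver.solve-∀
    negate : ∀ y ρ → y + 4 * - ρ ≡ y - 4 * ρ
    negate = solve-∀ ring

  AA-formula : ∀ r → (∀ {n} → 1 ℕ.≤ n → 4 * ι r < τ̄ * frac₂ (+ n) × τ̄ * frac₂ (+ n) < 4 * ι r + 4) →
               ∀ n → 1 ℕ.≤ n → AA t d s n ≡ t ℤ.* A t d s n ℤ.+ ℤ.- d ℤ.* + n ℤ.+ r
  AA-formula r window n 1≤n =
    floor-unique (A-pos 1≤n) (mk< (0<⇒positive (*-cancelˡ-< {2} {0#} {X} 0<2 0<2X)))
                 (mk< (subst SignedPositive (shift (ι (+ 2 ℤ.* k)) (ι a * τ)) (positive (*-cancelˡ-< {2} {X} {2} 0<2 2X<4))))
    where
    a = A t d s n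
    k = t ℤ.* a ℤ.+ ℤ.- d ℤ.* + n ℤ.+ r
    X = ι a * τ - ι (+ 2 ℤ.* k)
    y = τ̄ * frac₂ (+ n)
    0<2X : 2 * 0# < 2 * X
    0<2X = subst (0# <_) (sym (twice-frac-at-A r n)) (<⇒0<- (proj₁ (window 1≤n)))
    rearrange : ∀ y ρ → 4 * ρ + 4 - y ≡ 2 * 2 - (y - 4 * ρ)
    rearrange = solve-∀ ring
    2X<4 : 2 * X < 2 * 2
    2X<4 = mk< (subst (λ z → SignedPositive (2 * 2 - z)) (sym (twice-frac-at-A r n))
                      (subst SignedPositive (rearrange y (ι r)) (positive (proj₂ (window 1≤n)))))
    shift : ∀ x y → 2 - (y - x) ≡ x + 2 - y
    shift = solve-∀ ring

  if-direction : - 2 < τ̄ → τ̄ < 2 → IsGBS t d s (AA t d s)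
  if-direction -2<τ̄ τ̄<2 = by-sign (<-cmp 0# τ̄)
    where
    negate : ∀ e → - (2 * e) ≡ - 2 * e
    negate = solve-∀ ring
    by-sign : 0# < τ̄ ⊎ τ̄ < 0# ⊎ 0# ≡ τ̄ → IsGBS t d s (AA t d s)
    by-sign (inj₁ 0<τ̄) = t , ℤ.- d , 0ℤ , AA-formula 0ℤ window
      where
      window : ∀ {n} → 1 ℕ.≤ n → 0# < τ̄ * frac₂ (+ n) × τ̄ * frac₂ (+ n) < 4
      window 1≤n = *-pos 0<τ̄ (proj₁ (frac₂-bounds′ 1≤n)) ,
                   <-trans (*-monoʳ-< (proj₁ (frac₂-bounds′ 1≤n)) τ̄<2) (*-monoˡ-< 0<2 (proj₂ (frac₂-bounds′ 1≤n)))
    by-sign (inj₂ (inj₁ τ̄<0)) = t , ℤ.- d , -1ℤ , AA-formula -1ℤ window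
      where
      window : ∀ {n} → 1 ℕ.≤ n → - 4 < τ̄ * frac₂ (+ n) × τ̄ * frac₂ (+ n) < 0#
      window {n} 1≤n =
        <-trans (subst (- 4 <_) (negate (frac₂ (+ n))) (neg-mono-< (*-monoˡ-< 0<2 (proj₂ (frac₂-bounds′ 1≤n)))))
                (*-monoʳ-< (proj₁ (frac₂-bounds′ 1≤n)) -2<τ̄) ,
        *-monoʳ-< (proj₁ (frac₂-bounds′ 1≤n)) τ̄<0
    by-sign (inj₂ (inj₂ 0≡τ̄)) = ⊥-elim (τ̄≢0 (sym 0≡τ̄))

  module Rigidity {p q r : ℤ} (H : ∀ n → 1 ℕ.≤ n → AA t d s n ≡ p ℤ.* A t d s n ℤ.+ q ℤ.* + n ℤ.+ r) where

    -- c = 4(α² − pα − q) and w = 2(t − p) − 2ᾱ.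
    c w : ℤ[√ D ]
    c = ι (+ 2 ℤ.* (t ℤ.- p)) * τ - ι (+ 4 ℤ.* (d ℤ.+ q))
    w = ι (+ 2 ℤ.* (t ℤ.- p)) - τ̄

    scaled-deviation : ∀ {n} → 1 ℕ.≤ n → ι (+ n) * c ≡ 2 * frac₂ (A t d s n) + frac₂ (+ n) * w + 4 * ι r
    scaled-deviation {n} 1≤n = begin
      N * c                                                                   ≡⟨ cong₂ (λ x y → N * (x * τ - y)) (ι-* (+ 2) (t ℤ.- p)) (ι-* (+ 4) (d ℤ.+ q)) ⟩
      N * (2 * (T - P) * τ - 4 * (Dd + Q))                                    ≡⟨ key N Â τ τ̄ T Dd P Q R ⟩
      τ̄ * (N * τ - 2 * Â) + 4 * (T * Â - Dd * N - (P * Â + Q * N + R)) + (N * τ - 2 * Â) * (2 * (T - P) - τ̄) + 4 * R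
        ≡⟨ cong₂ (λ x y → τ̄ * (N * τ - x) + 4 * y + (N * τ - x) * (2 * (T - P) - τ̄) + 4 * R) (ι-* (+ 2) a) ι-deviation ⟨
      τ̄ * e + 4 * ι (t ℤ.* a ℤ.- d ℤ.* + n ℤ.- (p ℤ.* a ℤ.+ q ℤ.* + n ℤ.+ r)) + e * (2 * (T - P) - τ̄) + 4 * R
        ≡⟨ cong₂ (λ x y → τ̄ * e + 4 * ι (t ℤ.* a ℤ.- d ℤ.* + n ℤ.- x) + e * (y - τ̄) + 4 * R) (H n 1≤n) (ι-* (+ 2) (t ℤ.- p)) ⟨
      τ̄ * e + 4 * ι (t ℤ.* a ℤ.- d ℤ.* + n ℤ.- F a) + e * w + 4 * R          ≡⟨ cong (λ x → x + e * w + 4 * R) (beatty-identity a (+ n) (F a)) ⟨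
      2 * frac₂ a + e * w + 4 * R                                             ∎
      where
      open ≡-Reasoning
      a = A t d s n
      N = ι (+ n)
      Â = ι a
      T = ι t
      Dd = ι d
      P = ι p
      Q = ι q
      R = ι r
      e = frac₂ (+ n)
      key : ∀ N Â τ τ̄ T Dd P Q R → N * (2 * (T - P) * τ - 4 * (Dd + Q)) ≡
            τ̄ * (N * τ - 2 * Â) + 4 * (T * Â - Dd * N - (P * Â + Q * N + R)) + (N * τ - 2 * Â) * (2 * (T - P) - τ̄) + 4 * R
      key = solve-∀ ring
      ι-deviation : ι (t ℤ.* a ℤ.- d ℤ.* + n ℤ.- (p ℤ.* a ℤ.+ q ℤ.* + n ℤ.+ r)) ≡ T * Â - Dd * N - (P * Â + Q * N + R)
      ι-deviation = trans (cong₂ (λ x y → x - y - (ι (p ℤ.* a) + ι (q ℤ.* + n) + R)) (ι-* t a) (ι-* d (+ n)))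
                          (cong₂ (λ x y → T * Â - Dd * N - (x + y + R)) (ι-* p a) (ι-* q (+ n)))

    M₀ : ℤ[√ D ]
    M₀ = 3 * (16 + 4 * (w * w) + (4 * ι r) * (4 * ι r))

    deviation-bound : ∀ {n} → 1 ℕ.≤ n → (ι (+ n) * c) * (ι (+ n) * c) ≤ M₀
    deviation-bound {n} 1≤n =
      subst (λ z → z * z ≤ M₀) (sym (scaled-deviation 1≤n))
        (≤-trans {S * S} {3 * squares} (square-of-sum₃ (2 * E) (e * w) (4 * ι r))
                 (*-monoˡ-≤ {3} {squares} (inj₁ (ι-mono-< (+<+ (s≤s z≤n)))) squares-bound))
      where
      E = frac₂ (A t d s n)
      e = frac₂ (+ n)
      S = 2 * E + e * w + 4 * ι r
      squares = 2 * E * (2 * E) + e * w * (e * w) + 4 * ι r * (4 * ι r)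
      2E-bound : 2 * E * (2 * E) ≤ 16
      2E-bound = square-mono {2 * E} {4} (inj₁ (*-pos {2} {E} 0<2 (proj₁ (frac₂-bounds (A-pos 1≤n)))))
                                         (inj₁ (*-monoˡ-< {2} {E} {2} 0<2 (proj₂ (frac₂-bounds (A-pos 1≤n)))))
      regroup : ∀ e w → e * w * (e * w) ≡ e * e * (w * w)
      regroup = solve-∀ ring
      ew-bound : e * w * (e * w) ≤ 4 * (w * w)
      ew-bound = subst (_≤ 4 * (w * w)) (sym (regroup e w))
                       (*-monoʳ-≤ {w * w} {e * e} {4} (square-nonNeg w)
                                  (square-mono {e} {2} (inj₁ (proj₁ (frac₂-bounds′ 1≤n))) (inj₁ (proj₂ (frac₂-bounds′ 1≤n)))))
      squares-bound : squares ≤ 16 + 4 * (w * w) + 4 * ι r * (4 * ι r)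
      squares-bound = +-mono-≤ {2 * E * (2 * E) + e * w * (e * w)} {16 + 4 * (w * w)}
                               (+-mono-≤ {2 * E * (2 * E)} {16} 2E-bound ew-bound) (inj₂ refl)

    ¬c≢0 : c ≢ 0# → ⊥
    ¬c≢0 c≢0 = <-irrefl {M₀} (<-≤-trans {M₀} {ι (+ n) * (c * c)} M₀<ncc (≤-trans {ι (+ n) * (c * c)} ncc≤ (deviation-bound 1≤n)))
      where
      large = archimedean-property (square-pos c≢0) M₀
      n = proj₁ large
      1≤n = proj₁ (proj₂ large)
      M₀<ncc = proj₂ (proj₂ large)
      regroup : ∀ n c → n * (n * (c * c)) ≡ n * c * (n * c)
      regroup = solve-∀ ring
      ncc≤ : ι (+ n) * (c * c) ≤ (ι (+ n) * c) * (ι (+ n) * c)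
      ncc≤ = subst (ι (+ n) * (c * c) ≤_) (regroup (ι (+ n)) c)
                   (≤-*-self {ι (+ n)} {ι (+ n) * (c * c)} (ι-mono-≤ (+≤+ 1≤n))
                             (inj₁ (*-pos {ι (+ n)} {c * c} (ι-mono-< (+<+ 1≤n)) (square-pos c≢0))))

    c≡0 : c ≡ 0#
    c≡0 = by-cases (<-cmp 0# c)
      where
      by-cases : 0# < c ⊎ c < 0# ⊎ 0# ≡ c → c ≡ 0#
      by-cases (inj₁ 0<c) = ⊥-elim (¬c≢0 (λ c≡0 → <-irrefl (subst (0# <_) c≡0 0<c)))
      by-cases (inj₂ (inj₁ c<0)) = ⊥-elim (¬c≢0 (λ c≡0 → <-irrefl (subst (_< 0#) c≡0 c<0)))
      by-cases (inj₂ (inj₂ 0≡c)) = sym 0≡c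

    coefficients : p ≡ t × q ≡ ℤ.- d
    coefficients = sym (ℤₚ.i-j≡0⇒i≡j t p (cancel-2 2[t-p]≡0)) , q≡-d
      where
      x = + 2 ℤ.* (t ℤ.- p)
      y = + 4 ℤ.* (d ℤ.+ q)
      im-identity : ∀ x t → x ℤ.* 1ℤ ℤ.+ 0ℤ ℤ.* t ℤ.+ ℤ.- 0ℤ ≡ x
      im-identity = ℤ-Solver.solve-∀
      re-identity : ∀ x t D y → x ℤ.* t ℤ.+ 0ℤ ℤ.* 1ℤ ℤ.* D ℤ.+ ℤ.- y ≡ x ℤ.* t ℤ.- y
      re-identity = ℤ-Solver.solve-∀
      2[t-p]≡0 : x ≡ 0ℤ
      2[t-p]≡0 = trans (sym (im-identity x t)) (cong im c≡0)
      cancel-2 : ∀ {i} → + 2 ℤ.* i ≡ 0ℤ → i ≡ 0ℤ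
      cancel-2 2i≡0 = [ (λ ()) , id ]′ (ℤₚ.i*j≡0⇒i≡0∨j≡0 (+ 2) 2i≡0)
      -y≡0 : ℤ.- y ≡ 0ℤ
      -y≡0 = begin
        ℤ.- y               ≡⟨ ℤₚ.+-identityˡ (ℤ.- y) ⟨
        0ℤ ℤ.- y            ≡⟨ cong (λ z → z ℤ.* t ℤ.- y) 2[t-p]≡0 ⟨
        x ℤ.* t ℤ.- y       ≡⟨ trans (sym (re-identity x t D y)) (cong re c≡0) ⟩
        0ℤ                  ∎
        where open ≡-Reasoning
      q≡-d : q ≡ ℤ.- d
      q≡-d = begin
        q                       ≡⟨ isolate d q ⟩
        d ℤ.+ q ℤ.- d           ≡⟨ cong (ℤ._- d) (cancel-4 (ℤₚ.neg-injective -y≡0)) ⟩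
        0ℤ ℤ.- d                ≡⟨ ℤₚ.+-identityˡ (ℤ.- d) ⟩
        ℤ.- d                   ∎
        where
        open ≡-Reasoning
        isolate : ∀ d q → q ≡ d ℤ.+ q ℤ.- d
        isolate = ℤ-Solver.solve-∀
        cancel-4 : ∀ {i} → + 4 ℤ.* i ≡ 0ℤ → i ≡ 0ℤ
        cancel-4 4i≡0 = [ (λ ()) , id ]′ (ℤₚ.i*j≡0⇒i≡0∨j≡0 (+ 4) 4i≡0)

  dichotomy : (- 2 < τ̄ × τ̄ < 2) ⊎ 0# < τ̄ * τ̄ - 4
  dichotomy = compare-left (<-cmp τ̄ 2) (<-cmp (- 2) τ̄)
    where
    0<4 : 0# < 4
    0<4 = ι-mono-< (+<+ (s≤s z≤n))
    below : ∀ x → (- 2 - x) * (2 - x) ≡ x * x - 4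
    below = solve-∀ ring
    above : ∀ x → (x - 2) * (x - 2 + 4) ≡ x * x - 4
    above = solve-∀ ring
    compare-left : τ̄ < 2 ⊎ 2 < τ̄ ⊎ τ̄ ≡ 2 → - 2 < τ̄ ⊎ τ̄ < - 2 ⊎ - 2 ≡ τ̄ → (- 2 < τ̄ × τ̄ < 2) ⊎ 0# < τ̄ * τ̄ - 4
    compare-left (inj₁ τ̄<2) (inj₁ -2<τ̄) = inj₁ (-2<τ̄ , τ̄<2)
    compare-left (inj₁ τ̄<2) (inj₂ (inj₁ τ̄<-2)) =
      inj₂ (subst (0# <_) (below τ̄) (*-pos { - 2 - τ̄} {2 - τ̄} (<⇒0<- τ̄<-2) (<⇒0<- τ̄<2)))
    compare-left _ (inj₂ (inj₂ -2≡τ̄)) = ⊥-elim (case cong im -2≡τ̄ of λ ())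
    compare-left (inj₂ (inj₁ 2<τ̄)) _ =
      inj₂ (subst (0# <_) (above τ̄) (*-pos {τ̄ - 2} {τ̄ - 2 + 4} (<⇒0<- 2<τ̄) (<-trans (<⇒0<- 2<τ̄) (x<x+y 0<4))))
    compare-left (inj₂ (inj₂ τ̄≡2)) _ = ⊥-elim (case cong im τ̄≡2 of λ ())

  module Expansion {r : ℤ} (H : ∀ n → 1 ℕ.≤ n → AA t d s n ≡ t ℤ.* A t d s n ℤ.+ ℤ.- d ℤ.* + n ℤ.+ r) where

    -- W m = 4({mα}(ᾱ − 1) − r); replacing m by ⌊mα⌋ multiplies it by ᾱ.
    W : ℤ → ℤ[√ D ]
    W m = frac₂ m * (τ̄ - 2) - 4 * ι r

    W-step : ∀ {n} → 1 ℕ.≤ n → 2 * W (A t d s n) ≡ τ̄ * W (+ n)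
    W-step {n} 1≤n = begin
      2 * (E * (τ̄ - 2) - 4 * R)              ≡⟨ distribute E τ̄ R ⟩
      2 * E * (τ̄ - 2) - 2 * (4 * R)          ≡⟨ cong (λ x → x * (τ̄ - 2) - 2 * (4 * R)) 2E≡ ⟩
      (τ̄ * e - 4 * R) * (τ̄ - 2) - 2 * (4 * R) ≡⟨ collect e τ̄ R ⟩
      τ̄ * (e * (τ̄ - 2) - 4 * R)              ∎
      where
      open ≡-Reasoning
      E = frac₂ (A t d s n)
      e = frac₂ (+ n)
      R = ι r
      distribute : ∀ E τ̄ R → 2 * (E * (τ̄ - 2) - 4 * R) ≡ 2 * E * (τ̄ - 2) - 2 * (4 * R)
      distribute = solve-∀ ring
      collect : ∀ e τ̄ R → (τ̄ * e - 4 * R) * (τ̄ - 2) - 2 * (4 * R) ≡ τ̄ * (e * (τ̄ - 2) - 4 * R)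
      collect = solve-∀ ring
      2E≡ : 2 * E ≡ τ̄ * e - 4 * R
      2E≡ = subst (λ k → 2 * (ι (A t d s n) * τ - ι (+ 2 ℤ.* k)) ≡ τ̄ * e - 4 * R) (sym (H n 1≤n)) (twice-frac-at-A r n)

    W²-step : ∀ {n} → 1 ℕ.≤ n → 4 * (W (A t d s n) * W (A t d s n)) ≡ (4 + (τ̄ * τ̄ - 4)) * (W (+ n) * W (+ n))
    W²-step {n} 1≤n = begin
      4 * (W′ * W′)                  ≡⟨ square-twice W′ ⟩
      (2 * W′) * (2 * W′)            ≡⟨ cong (λ x → x * x) (W-step 1≤n) ⟩
      (τ̄ * W₀) * (τ̄ * W₀)            ≡⟨ regroup τ̄ W₀ ⟩
      (4 + (τ̄ * τ̄ - 4)) * (W₀ * W₀)  ∎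
      where
      open ≡-Reasoning
      W′ = W (A t d s n)
      W₀ = W (+ n)
      square-twice : ∀ x → 4 * (x * x) ≡ (2 * x) * (2 * x)
      square-twice = solve-∀ ring
      regroup : ∀ τ̄ x → (τ̄ * x) * (τ̄ * x) ≡ (4 + (τ̄ * τ̄ - 4)) * (x * x)
      regroup = solve-∀ ring

    M₁ : ℤ[√ D ]
    M₁ = 2 * (4 * ((τ̄ - 2) * (τ̄ - 2)) + (4 * ι r) * (4 * ι r))

    W²-bound : ∀ {n} → 1 ℕ.≤ n → W (+ n) * W (+ n) ≤ M₁
    W²-bound {n} 1≤n =
      ≤-trans {W (+ n) * W (+ n)} {2 * (x * x + - (4 * ι r) * - (4 * ι r))}
              (square-of-sum₂ x (- (4 * ι r)))
              (*-monoˡ-≤ {2} {x * x + - (4 * ι r) * - (4 * ι r)} (inj₁ 0<2)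
                         (+-mono-≤ {x * x} {4 * ((τ̄ - 2) * (τ̄ - 2))} x-bound (inj₂ (neg-square (4 * ι r)))))
      where
      e = frac₂ (+ n)
      x = e * (τ̄ - 2)
      neg-square : ∀ x → - x * - x ≡ x * x
      neg-square = solve-∀ ring
      regroup : ∀ e u → e * u * (e * u) ≡ e * e * (u * u)
      regroup = solve-∀ ring
      x-bound : x * x ≤ 4 * ((τ̄ - 2) * (τ̄ - 2))
      x-bound = subst (_≤ 4 * ((τ̄ - 2) * (τ̄ - 2))) (sym (regroup e (τ̄ - 2)))
                      (*-monoʳ-≤ {(τ̄ - 2) * (τ̄ - 2)} {e * e} {4} (square-nonNeg (τ̄ - 2))
                                 (square-mono {e} {2} (inj₁ (proj₁ (frac₂-bounds′ 1≤n))) (inj₁ (proj₂ (frac₂-bounds′ 1≤n)))))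

    -- frac₂ 1 − frac₂ 2 and τ̄ − 2 are nonzero, so W(1) and W(2) cannot both vanish.
    opaque
      nonvanishing-start : ∃[ n₀ ] (1 ℕ.≤ n₀ × W (+ n₀) ≢ 0#)
      nonvanishing-start = by-cases (<-cmp 0# (W (+ 1)))
        where
        e₁ e₂ : ℤ[√ D ]
        e₁ = frac₂ (+ 1)
        e₂ = frac₂ (+ 2)
        difference : ∀ e₁ e₂ u R → (e₁ - e₂) * u ≡ (e₁ * u - 4 * R) - (e₂ * u - 4 * R)
        difference = solve-∀ ring
        e₁-e₂≢0 : e₁ - e₂ ≢ 0#
        e₁-e₂≢0 eq = case cong im eq of λ ()
        τ̄-2≢0 : τ̄ - 2 ≢ 0#
        τ̄-2≢0 eq = case cong im eq of λ ()
        by-cases : 0# < W (+ 1) ⊎ W (+ 1) < 0# ⊎ 0# ≡ W (+ 1) → ∃[ n₀ ] (1 ℕ.≤ n₀ × W (+ n₀) ≢ 0#)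
        by-cases (inj₁ 0<W₁) = 1 , s≤s z≤n , λ W₁≡0 → <-irrefl (subst (0# <_) W₁≡0 0<W₁)
        by-cases (inj₂ (inj₁ W₁<0)) = 1 , s≤s z≤n , λ W₁≡0 → <-irrefl (subst (_< 0#) W₁≡0 W₁<0)
        by-cases (inj₂ (inj₂ 0≡W₁)) = 2 , s≤s (z≤n) , λ W₂≡0 → *-≢0 e₁-e₂≢0 τ̄-2≢0 (begin
          (e₁ - e₂) * (τ̄ - 2)  ≡⟨ difference e₁ e₂ (τ̄ - 2) (ι r) ⟩
          W (+ 1) - W (+ 2)    ≡⟨ cong₂ _-_ (sym 0≡W₁) W₂≡0 ⟩
          0# - 0#              ∎)
          where open ≡-Reasoning

    module Orbit (n₀ : ℕ) (1≤n₀ : 1 ℕ.≤ n₀) where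
      orbit : ℕ → ℕ
      orbit zero = n₀
      orbit (suc k) = ℤ.∣ A t d s (orbit k) ∣

      orbit-pos : ∀ k → 1 ℕ.≤ orbit k
      orbit-pos zero = 1≤n₀
      orbit-pos (suc k) = IntegerFacts.0<⇒1≤∣∣ (A-pos (orbit-pos k))

      v : ℕ → ℤ[√ D ]
      v k = W (+ orbit k) * W (+ orbit k)

      v-step : ∀ k → 4 * v (suc k) ≡ (4 + (τ̄ * τ̄ - 4)) * v k
      v-step k = trans (cong (λ m → 4 * (W m * W m)) (ℤₚ.0≤i⇒+∣i∣≡i (ℤₚ.<⇒≤ (A-pos (orbit-pos k))))) (W²-step (orbit-pos k))

    ¬expanding : 0# < τ̄ * τ̄ - 4 → ⊥
    ¬expanding 0<g = <-irrefl {M₁} (<-≤-trans {M₁} {v k} M₁<vₖ (W²-bound (orbit-pos k)))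
      where
      start = nonvanishing-start
      open Orbit (proj₁ start) (proj₁ (proj₂ start))
      large = unbounded-growth archimedean-property 0<g v (square-pos (proj₂ (proj₂ start))) v-step M₁
      k = proj₁ large
      M₁<vₖ = proj₂ large


  only-if : IsGBS t d s (AA t d s) → ConjAbsLt1 t d s
  only-if (p , q , r , H) = [ Equivalence.from ConjAbsLt1⇔ , ⊥-elim ∘ Expansion.¬expanding {r} H′ ]′ dichotomy
    where
    H′ : ∀ n → 1 ℕ.≤ n → AA t d s n ≡ t ℤ.* A t d s n ℤ.+ ℤ.- d ℤ.* + n ℤ.+ r
    H′ = subst₂ (λ p q → ∀ n → 1 ℕ.≤ n → AA t d s n ≡ p ℤ.* A t d s n ℤ.+ q ℤ.* + n ℤ.+ r)
                (proj₁ (Rigidity.coefficients {p} {q} {r} H)) (proj₂ (Rigidity.coefficients {p} {q} {r} H)) H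

open import Data.Integer using (ℤ; _*_; _<_; 0ℤ; 1ℤ; -1ℤ)
open import Data.Sum using (_⊎_)
open import Relation.Nullary using (¬_)
open import Relation.Binary.PropositionalEquality using (_≡_)
open import Function.Bundles using (_⇔_)

theorem1 : (t d s : ℤ) → (s ≡ 1ℤ ⊎ s ≡ -1ℤ) → 0ℤ < disc t d
         → (∀ (k : ℤ) → ¬ (k * k ≡ disc t d))
         → AlphaGt1 t d s
         → IsGBS t d s (AA t d s) ⇔ ConjAbsLt1 t d s
theorem1 t d s s≡±1 0<D nonsquare α>1 =
  mk⇔ only-if (uncurry if-direction ∘ Equivalence.to ConjAbsLt1⇔)
  where open GeneralizedBeatty t d s s≡±1 0<D nonsquare α>1
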